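{- For every integer $n\geqslant 1$, $C_n(x)=\det H_n$, where $H_n=(h_{ij})_{1\leqslant i,j\leqslant n}$ is the $n\times n$ lower Hessenberg matrix with entries $$h_{ij}=\begin{cases}\binom{i}{j-1}C_{i-j}(x), & j<i,\\ \binom{i}{i-1}x=ix, & j=i,\\ -1, & j=i+1,\\ 0, & j>i+1.\end{cases}$$ That is, $$C_{n}(x)=\begin{vmatrix} x&-1&0&\cdots&0&0\\ C_1(x)&\binom{2}{1}x&-1&\cdots&0&0\\ C_2(x)&\binom{3}{1}C_1(x)&\binom{3}{2}x&\cdots&0&0\\ \vdots&\vdots&\vdots&\ddots&\vdots&\vdots\\ C_{n-2}(x)&\binom{n-1}{1}C_{n-3}(x)&\binom{n-1}{2}C_{n-4}(x)&\cdots&\binom{n-1}{n-2}x&-1\\ C_{n-1}(x)&\binom{n}{1}C_{n-2}(x)&\binom{n}{2}C_{n-3}(x)&\cdots&\binom{n}{n-2}C_1(x)&\binom{n}{n-1}x \end{vmatrix}.$$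
   Context: For $n\geqslant 1$, $\mathcal{Q}_n$ denotes the set of Stirling permutations of the multiset $\{1,1,2,2,\ldots,n,n\}$, i.e. words $\sigma=\sigma_1\cdots\sigma_{2n}$ using each of $1,\ldots,n$ exactly twice such that for each $i$ all letters between the two occurrences of $i$ are at least $i$. Set $\sigma_0=\sigma_{2n+1}=0$, and let ${\rm des}(\sigma)=\#\{i\in\{0,1,\ldots,2n\}:\sigma_i>\sigma_{i+1}\}$. The second-order Eulerian polynomials are $C_n(x)=\sum_{\sigma\in\mathcal{Q}_n}x^{{\rm des}(\sigma)}$ for $n\geqslant1$, and $C_0(x)=1$. -}

module Defs where

open import Level using (Level)
open import Algebra.Bundles using (CommutativeRing)
open import Data.Nat as ℕ using (ℕ; zero; suc; _≡ᵇ_; _≤ᵇ_; _<ᵇ_)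
open import Data.Nat.Combinatorics using (_C_)
open import Data.Bool using (Bool; true; false; _∧_; not; if_then_else_)
open import Data.List using (List; []; _∷_; map; concatMap; upTo; filter; foldr; takeWhile; _++_; [_])
open import Data.Bool.ListAction using (all; any)
open import Data.Fin using (Fin; toℕ; punchIn)
open import Relation.Nullary.Decidable using (does)
open import Data.Bool using (T)
open import Data.Bool.Properties using (T?)

words : ℕ → ℕ → List (List ℕ)
words zero    n = [ [] ]
words (suc k) n = concatMap (λ w → map (λ a → a ∷ w) (map suc (upTo n))) (words k n)

occ : ℕ → List ℕ → ℕ
occ i []      = 0
occ i (a ∷ w) = if i ≡ᵇ a then suc (occ i w) else occ i w

twiceEach : ℕ → List ℕ → Bool
twiceEach n w = all (λ i → occ i w ≡ᵇ 2) (map suc (upTo n))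

-- Stirling condition: for every letter a at the first of its two
-- occurrences, all letters strictly between it and the next occurrence
-- of a are ≥ a.
stirlingCond : List ℕ → Bool
stirlingCond []      = true
stirlingCond (a ∷ w) =
  (if any (λ b → a ≡ᵇ b) w
     then all (λ b → a ≤ᵇ b) (takeWhile (λ b → T? (not (a ≡ᵇ b))) w)
     else true)
  ∧ stirlingCond w

isStirling : ℕ → List ℕ → Bool
isStirling n w = twiceEach n w ∧ stirlingCond w

Q : ℕ → List (List ℕ)
Q n = filter (λ w → T? (isStirling n w)) (words (2 ℕ.* n) n)

descents : List ℕ → ℕ
descents []          = 0
descents (a ∷ [])    = 0
descents (a ∷ b ∷ w) = (if b <ᵇ a then 1 else 0) ℕ.+ descents (b ∷ w)

des : List ℕ → ℕ
des σ = descents (0 ∷ σ ++ [ 0 ])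

-- Ring-valued definitions (evaluation of the polynomials at x ∈ R,
-- for an arbitrary commutative ring R; taking R = ℤ[x] gives the
-- polynomial identity).

module WithRing {c ℓ : Level} (R : CommutativeRing c ℓ) where
  open CommutativeRing R

  _^_ : Carrier → ℕ → Carrier
  a ^ zero  = 1#
  a ^ suc k = a * (a ^ k)

  fromℕ : ℕ → Carrier
  fromℕ zero    = 0#
  fromℕ (suc k) = 1# + fromℕ k

  sumR : List Carrier → Carrier
  sumR = foldr _+_ 0#

  Cₙ : Carrier → ℕ → Carrier
  Cₙ x zero      = 1#
  Cₙ x (suc n)   = sumR (map (λ σ → x ^ des σ) (Q (suc n)))

  ΣFin : (n : ℕ) → (Fin n → Carrier) → Carrier
  ΣFin zero    f = 0#
  ΣFin (suc n) f = f Fin.zero + ΣFin n (λ j → f (Fin.suc j))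
    where import Data.Fin as Fin

  sign : ℕ → Carrier
  sign zero    = 1#
  sign (suc k) = - sign k

  det : (n : ℕ) → (Fin n → Fin n → Carrier) → Carrier
  det zero    M = 1#
  det (suc n) M =
    ΣFin (suc n) (λ j → sign (toℕ j) * (M Fin.zero j *
      det n (λ r s → M (Fin.suc r) (punchIn j s))))
    where import Data.Fin as Fin

  -- entry h_{ij} of H_n, with 1-based indices i, j
  h : Carrier → ℕ → ℕ → Carrier
  h x i j =
    if j <ᵇ i then fromℕ (i C (j ℕ.∸ 1)) * Cₙ x (i ℕ.∸ j)
    else if j ≡ᵇ i then fromℕ (i C (i ℕ.∸ 1)) * x
    else if j ≡ᵇ suc i then - 1#
    else 0#

  H : Carrier → (n : ℕ) → Fin n → Fin n → Carrier
  H x n i j = h x (suc (toℕ i)) (suc (toℕ j))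

-- Inserting the pair (n+1)(n+1) into one of the 2n+1 gaps of a Stirling permutation in 𝒬ₙ
-- gives every element of 𝒬ₙ₊₁ exactly once, and creates a new descent unless the gap is a
-- descent; hence C_{n+1} = (2n+1) x Cₙ + x(1 − x) Cₙ′.  For the exponential generating function
-- C(z) this reads C′ = x (2z C′ + C) + (1 − x) x ∂ₓC; by the Leibniz rule C² (C − 1 + x) obeys the
-- matching equation, and induction on coefficients gives C′ = C² (C − 1 + x).  Consequently
-- E = 1 + (1 − x) z − ∫₀ᶻ C satisfies (C E)′ = C (C − 1 + x) (C E − 1), so C E = 1, and the
-- coefficients of C E = 1 are the recurrence C_{n+1} = ∑ⱼ h_{n+1,j+1} Cⱼ.  Expanding det Hₙ₊₁
-- along its first row, which has only the entries h₁₁ and −1, shows that the determinants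
-- satisfy the same recurrence.  Derivatives in x are computed over the dual numbers.

module Submission where

open import Defs
open import Level using (Level)
open import Algebra.Bundles using (CommutativeRing)
open import Data.Nat using (ℕ; zero; suc; _≤_)
open import Data.Fin using (toℕ)
open import Data.Product using (_,_; proj₂)

module IntegerCoefficients {c ℓ : Level} (R : CommutativeRing c ℓ) where
  import Data.Nat as ℕ
  import Data.Nat.Properties as ℕ
  open import Data.Integer as ℤ using (ℤ; +_; -[1+_]; _⊖_)
  import Data.Integer.Properties as ℤ
  open import Data.Sign as Sign using (Sign)
  open import Data.Maybe using (Maybe; just; nothing)
  open import Relation.Nullary using (yes; no)
  import Relation.Binary.PropositionalEquality as ≡
  open CommutativeRing R
  open WithRing R using (fromℕ)
  open import Relation.Binary.Reasoning.Setoid setoid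
  open import Algebra.Properties.Ring ring using (-‿distribˡ-*; -‿distribʳ-*; -‿involutive; -0#≈0#; -‿+-comm)
  open import Algebra.Properties.CommutativeSemigroup +-commutativeSemigroup
    using () renaming (interchange to +-interchange)
  open import Algebra.Solver.Ring.AlmostCommutativeRing
  open import Algebra.Properties.Semiring.Mult.TCOptimised semiring using (_×_; 1+×; ×-homo-+; ×1-homo-*)

  fromℕ-+ : ∀ m n → fromℕ (m ℕ.+ n) ≈ fromℕ m + fromℕ n
  fromℕ-+ zero    n = sym (+-identityˡ _)
  fromℕ-+ (suc m) n = trans (+-congˡ (fromℕ-+ m n)) (sym (+-assoc _ _ _))

  signed : Sign → Carrier → Carrier
  signed Sign.+ a = a
  signed Sign.- a = - a

  signed-cong : ∀ s {a b} → a ≈ b → signed s a ≈ signed s b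
  signed-cong Sign.+ a≈b = a≈b
  signed-cong Sign.- a≈b = -‿cong a≈b

  signed-* : ∀ s t a b → signed (s Sign.* t) (a * b) ≈ signed s a * signed t b
  signed-* Sign.+ Sign.+ a b = refl
  signed-* Sign.+ Sign.- a b = -‿distribʳ-* a b
  signed-* Sign.- Sign.+ a b = -‿distribˡ-* a b
  signed-* Sign.- Sign.- a b = begin
    a * b              ≈⟨ sym (-‿involutive _) ⟩
    - - (a * b)        ≈⟨ -‿cong (-‿distribʳ-* a b) ⟩
    - (a * - b)        ≈⟨ -‿distribˡ-* a (- b) ⟩
    - a * - b          ∎

  -- With the type-checking optimised _×_, ι (+ 1) reduces to 1#, so constants in solver goals
  -- are recognised by refl.
  ι : ℤ → Carrier
  ι (+ n)     = n × 1#
  ι -[1+ n ]  = - (suc n × 1#)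

  ι-signAbs : ∀ i → ι i ≈ signed (ℤ.sign i) (ℤ.∣ i ∣ × 1#)
  ι-signAbs (+ n)    = refl
  ι-signAbs -[1+ n ] = refl

  ι-◃ : ∀ s n → ι (s ℤ.◃ n) ≈ signed s (n × 1#)
  ι-◃ Sign.+ zero    = refl
  ι-◃ Sign.- zero    = sym -0#≈0#
  ι-◃ Sign.+ (suc n) = refl
  ι-◃ Sign.- (suc n) = refl

  ι-* : ∀ i j → ι (i ℤ.* j) ≈ ι i * ι j
  ι-* i j = begin
    ι (s ℤ.◃ ℤ.∣ i ∣ ℕ.* ℤ.∣ j ∣)
      ≈⟨ ι-◃ s (ℤ.∣ i ∣ ℕ.* ℤ.∣ j ∣) ⟩
    signed s ((ℤ.∣ i ∣ ℕ.* ℤ.∣ j ∣) × 1#)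
      ≈⟨ signed-cong s (×1-homo-* ℤ.∣ i ∣ ℤ.∣ j ∣) ⟩
    signed s ((ℤ.∣ i ∣ × 1#) * (ℤ.∣ j ∣ × 1#))
      ≈⟨ signed-* (ℤ.sign i) (ℤ.sign j) _ _ ⟩
    signed (ℤ.sign i) (ℤ.∣ i ∣ × 1#) * signed (ℤ.sign j) (ℤ.∣ j ∣ × 1#)
      ≈⟨ sym (*-cong (ι-signAbs i) (ι-signAbs j)) ⟩
    ι i * ι j ∎
    where
    s : Sign
    s = ℤ.sign i Sign.* ℤ.sign j

  ι-⊖ : ∀ m n → ι (m ⊖ n) ≈ m × 1# - n × 1#
  ι-⊖ zero    zero    = sym (trans (+-congˡ -0#≈0#) (+-identityʳ 0#))
  ι-⊖ zero    (suc n) = sym (+-identityˡ _)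
  ι-⊖ (suc m) zero    = sym (trans (+-congˡ -0#≈0#) (+-identityʳ _))
  ι-⊖ (suc m) (suc n) = begin
    ι (suc m ⊖ suc n)                    ≡⟨ ≡.cong ι (ℤ.[1+m]⊖[1+n]≡m⊖n m n) ⟩
    ι (m ⊖ n)                            ≈⟨ ι-⊖ m n ⟩
    m × 1# - n × 1#                      ≈⟨ sym (cancel-1# (m × 1#) (n × 1#)) ⟩
    (1# + m × 1#) - (1# + n × 1#)        ≈⟨ sym (+-cong (1+× m 1#) (-‿cong (1+× n 1#))) ⟩
    suc m × 1# - suc n × 1#              ∎
    where
    cancel-1# : ∀ a b → (1# + a) - (1# + b) ≈ a - b
    cancel-1# a b = begin
      (1# + a) + - (1# + b)      ≈⟨ +-congˡ (sym (-‿+-comm 1# b)) ⟩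
      (1# + a) + (- 1# + - b)    ≈⟨ +-interchange 1# a (- 1#) (- b) ⟩
      (1# + - 1#) + (a + - b)    ≈⟨ +-congʳ (-‿inverseʳ 1#) ⟩
      0# + (a + - b)             ≈⟨ +-identityˡ _ ⟩
      a + - b                    ∎

  ι-+ : ∀ i j → ι (i ℤ.+ j) ≈ ι i + ι j
  ι-+ -[1+ m ] -[1+ n ] = begin
    - (suc (suc (m ℕ.+ n)) × 1#)            ≡⟨ ≡.cong (λ k → - (suc k × 1#)) (ℕ.+-suc m n) ⟨
    - ((suc m ℕ.+ suc n) × 1#)              ≈⟨ -‿cong (×-homo-+ 1# (suc m) (suc n)) ⟩
    - (suc m × 1# + suc n × 1#)             ≈⟨ sym (-‿+-comm _ _) ⟩
    - (suc m × 1#) + - (suc n × 1#)         ∎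
  ι-+ -[1+ m ] (+ n)    = trans (ι-⊖ n (suc m)) (+-comm _ _)
  ι-+ (+ m)    -[1+ n ] = ι-⊖ m (suc n)
  ι-+ (+ m)    (+ n)    = ×-homo-+ 1# m n

  ι-neg : ∀ i → ι (ℤ.- i) ≈ - ι i
  ι-neg -[1+ n ]      = sym (-‿involutive _)
  ι-neg (+ zero)      = sym -0#≈0#
  ι-neg (+ suc n)     = refl

  ι-homomorphism : ℤ.+-*-rawRing -Raw-AlmostCommutative⟶ fromCommutativeRing R
  ι-homomorphism = record
    { ⟦_⟧ = ι ; +-homo = ι-+ ; *-homo = ι-* ; -‿homo = ι-neg
    ; 0-homo = refl ; 1-homo = refl }

  ι-≟ : ∀ i j → Maybe (ι i ≈ ι j)
  ι-≟ i j with i ℤ.≟ j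
  ... | yes ≡.refl = just refl
  ... | no _       = nothing

  open import Algebra.Solver.Ring ℤ.+-*-rawRing (fromCommutativeRing R) ι-homomorphism ι-≟ public

  :0 :1 : ∀ {n} → Polynomial n
  :0 = con (+ 0)
  :1 = con (+ 1)

module DualNumbers {c ℓ : Level} (R : CommutativeRing c ℓ) where
  open import Data.Product using (_×_; _,_)
  open CommutativeRing R
  open IntegerCoefficients R using (solve; _:+_; _:*_; _:=_; :0; :1)

  -- (a , b) stands for a + b ε with ε² = 0.
  _≈ε_ : Carrier × Carrier → Carrier × Carrier → Set ℓ
  (a , b) ≈ε (a′ , b′) = a ≈ a′ × b ≈ b′

  R[ε] : CommutativeRing c ℓ
  R[ε] = record
    { Carrier = Carrier × Carrier
    ; _≈_ = _≈ε_
    ; _+_ = λ (a , b) (a′ , b′) → a + a′ , b + b′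
    ; _*_ = λ (a , b) (a′ , b′) → a * a′ , a * b′ + b * a′
    ; -_ = λ (a , b) → - a , - b
    ; 0# = 0# , 0#
    ; 1# = 1# , 0#
    ; isCommutativeRing = record
      { isRing = record
        { +-isAbelianGroup = record
          { isGroup = record
            { isMonoid = record
              { isSemigroup = record
                { isMagma = record
                  { isEquivalence = record
                    { refl = refl , refl
                    ; sym = λ (p , q) → sym p , sym q
                    ; trans = λ (p , q) (p′ , q′) → trans p p′ , trans q q′ }
                  ; ∙-cong = λ (p , q) (p′ , q′) → +-cong p p′ , +-cong q q′ }
                ; assoc = λ (a , b) (a′ , b′) (a″ , b″) → +-assoc a a′ a″ , +-assoc b b′ b″ }
              ; identity = (λ (a , b) → +-identityˡ a , +-identityˡ b)
                         , (λ (a , b) → +-identityʳ a , +-identityʳ b) }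
            ; inverse = (λ (a , b) → -‿inverseˡ a , -‿inverseˡ b)
                      , (λ (a , b) → -‿inverseʳ a , -‿inverseʳ b)
            ; ⁻¹-cong = λ (p , q) → -‿cong p , -‿cong q }
          ; comm = λ (a , b) (a′ , b′) → +-comm a a′ , +-comm b b′ }
        ; *-cong = λ (p , q) (p′ , q′) → *-cong p p′ , +-cong (*-cong p q′) (*-cong q p′)
        ; *-assoc = λ (a , b) (a′ , b′) (a″ , b″) → *-assoc a a′ a″ ,
            solve 6 (λ a b a′ b′ a″ b″ → (a :* a′) :* b″ :+ (a :* b′ :+ b :* a′) :* a″
                                       := a :* (a′ :* b″ :+ b′ :* a″) :+ b :* (a′ :* a″)) refl a b a′ b′ a″ b″
        ; *-identity = (λ (a , b) → *-identityˡ a , solve 2 (λ a b → :1 :* b :+ :0 :* a := b) refl a b)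
                     , (λ (a , b) → *-identityʳ a , solve 2 (λ a b → a :* :0 :+ b :* :1 := b) refl a b)
        ; distrib = (λ (a , b) (a′ , b′) (a″ , b″) → distribˡ a a′ a″ ,
                      solve 6 (λ a b a′ b′ a″ b″ → a :* (b′ :+ b″) :+ b :* (a′ :+ a″)
                                                 := a :* b′ :+ b :* a′ :+ (a :* b″ :+ b :* a″)) refl a b a′ b′ a″ b″)
                  , (λ (a , b) (a′ , b′) (a″ , b″) → distribʳ a a′ a″ ,
                      solve 6 (λ a b a′ b′ a″ b″ → (a′ :+ a″) :* b :+ (b′ :+ b″) :* a
                                                 := a′ :* b :+ b′ :* a :+ (a″ :* b :+ b″ :* a)) refl a b a′ b′ a″ b″)
        }
      ; *-comm = λ (a , b) (a′ , b′) → *-comm a a′ ,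
          solve 4 (λ a b a′ b′ → a :* b′ :+ b :* a′ := a′ :* b :+ b′ :* a) refl a b a′ b′ }
    }

module BinomialConvolution {c ℓ : Level} (R : CommutativeRing c ℓ) where
  open import Data.Nat as ℕ using (_<_; _∸_; z≤n; s≤s)
  import Data.Nat.Properties as ℕ
  open import Data.Nat.Induction using (<-rec)
  open import Data.Nat.Combinatorics using (_C_; nCk+nC[k+1]≡[n+1]C[k+1]; k>n⇒nCk≡0)
  import Relation.Binary.PropositionalEquality as ≡
  open CommutativeRing R hiding (zero)
  open WithRing R using (fromℕ)
  open IntegerCoefficients R using (solve; _:+_; _:*_; _:=_; :0; :1; fromℕ-+)
  open import Relation.Binary.Reasoning.Setoid setoid
  open import Algebra.Properties.CommutativeSemigroup +-commutativeSemigroup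
    using () renaming (interchange to +-interchange)

  Seq : Set c
  Seq = ℕ → Carrier

  infix 4 _≗_
  _≗_ : Seq → Seq → Set ℓ
  a ≗ b = ∀ n → a n ≈ b n

  shift : Seq → Seq
  shift a n = a (suc n)

  infixl 6 _⊕_
  _⊕_ : Seq → Seq → Seq
  (a ⊕ b) n = a n + b n

  infixl 7 _·_
  _·_ : Carrier → Seq → Seq
  (k · a) n = k * a n

  δ : Seq
  δ zero    = 1#
  δ (suc n) = 0#

  -- (a ⋆ b) n = ∑ₖ (n choose k) aₖ bₙ₋ₖ is the product of exponential generating
  -- functions; it is defined through the Leibniz rule for its derivative.
  infixl 7 _⋆_
  _⋆_ : Seq → Seq → Seq
  (a ⋆ b) zero    = a 0 * b 0
  (a ⋆ b) (suc n) = (shift a ⋆ b) n + (a ⋆ shift b) n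

  ⋆-cong : ∀ {a a′ b b′} → a ≗ a′ → b ≗ b′ → a ⋆ b ≗ a′ ⋆ b′
  ⋆-cong a≗a′ b≗b′ zero    = *-cong (a≗a′ 0) (b≗b′ 0)
  ⋆-cong a≗a′ b≗b′ (suc n) =
    +-cong (⋆-cong (λ m → a≗a′ (suc m)) b≗b′ n) (⋆-cong a≗a′ (λ m → b≗b′ (suc m)) n)

  ⋆-comm : ∀ a b → a ⋆ b ≗ b ⋆ a
  ⋆-comm a b zero    = *-comm _ _
  ⋆-comm a b (suc n) = trans (+-cong (⋆-comm (shift a) b n) (⋆-comm a (shift b) n)) (+-comm _ _)

  ⋆-distribʳ-⊕ : ∀ a a′ b → (a ⊕ a′) ⋆ b ≗ a ⋆ b ⊕ a′ ⋆ b
  ⋆-distribʳ-⊕ a a′ b zero    = distribʳ _ _ _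
  ⋆-distribʳ-⊕ a a′ b (suc n) = begin
    ((shift a ⊕ shift a′) ⋆ b) n + ((a ⊕ a′) ⋆ shift b) n
      ≈⟨ +-cong (⋆-distribʳ-⊕ (shift a) (shift a′) b n) (⋆-distribʳ-⊕ a a′ (shift b) n) ⟩
    ((shift a ⋆ b) n + (shift a′ ⋆ b) n) + ((a ⋆ shift b) n + (a′ ⋆ shift b) n)
      ≈⟨ +-interchange _ _ _ _ ⟩
    ((shift a ⋆ b) n + (a ⋆ shift b) n) + ((shift a′ ⋆ b) n + (a′ ⋆ shift b) n) ∎

  ⋆-distribˡ-⊕ : ∀ a b b′ → a ⋆ (b ⊕ b′) ≗ a ⋆ b ⊕ a ⋆ b′
  ⋆-distribˡ-⊕ a b b′ n = begin
    (a ⋆ (b ⊕ b′)) n          ≈⟨ ⋆-comm a (b ⊕ b′) n ⟩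
    ((b ⊕ b′) ⋆ a) n          ≈⟨ ⋆-distribʳ-⊕ b b′ a n ⟩
    (b ⋆ a) n + (b′ ⋆ a) n    ≈⟨ +-cong (⋆-comm b a n) (⋆-comm b′ a n) ⟩
    (a ⋆ b) n + (a ⋆ b′) n    ∎

  ⋆-assocˡ-· : ∀ k a b → (k · a) ⋆ b ≗ k · (a ⋆ b)
  ⋆-assocˡ-· k a b zero    = *-assoc _ _ _
  ⋆-assocˡ-· k a b (suc n) =
    trans (+-cong (⋆-assocˡ-· k (shift a) b n) (⋆-assocˡ-· k a (shift b) n)) (sym (distribˡ _ _ _))

  ⋆-assocʳ-· : ∀ k a b → a ⋆ (k · b) ≗ k · (a ⋆ b)
  ⋆-assocʳ-· k a b n = trans (⋆-comm a (k · b) n) (trans (⋆-assocˡ-· k b a n) (*-congˡ (⋆-comm b a n)))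

  ⋆-linearˡ : ∀ {a} y p z q b → a ≗ y · p ⊕ z · q → a ⋆ b ≗ y · (p ⋆ b) ⊕ z · (q ⋆ b)
  ⋆-linearˡ y p z q b a≗ n = begin
    (_ ⋆ b) n                                 ≈⟨ ⋆-cong a≗ (λ _ → refl) n ⟩
    ((y · p ⊕ z · q) ⋆ b) n                   ≈⟨ ⋆-distribʳ-⊕ (y · p) (z · q) b n ⟩
    ((y · p) ⋆ b) n + ((z · q) ⋆ b) n         ≈⟨ +-cong (⋆-assocˡ-· y p b n) (⋆-assocˡ-· z q b n) ⟩
    y * (p ⋆ b) n + z * (q ⋆ b) n             ∎

  ⋆-linearʳ : ∀ {b} a y p z q → b ≗ y · p ⊕ z · q → a ⋆ b ≗ y · (a ⋆ p) ⊕ z · (a ⋆ q)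
  ⋆-linearʳ {b} a y p z q b≗ n = begin
    (a ⋆ b) n                       ≈⟨ ⋆-comm a b n ⟩
    (b ⋆ a) n                       ≈⟨ ⋆-linearˡ y p z q a b≗ n ⟩
    y * (p ⋆ a) n + z * (q ⋆ a) n   ≈⟨ +-cong (*-congˡ (⋆-comm p a n)) (*-congˡ (⋆-comm q a n)) ⟩
    y * (a ⋆ p) n + z * (a ⋆ q) n   ∎

  ⋆-assoc : ∀ a b d → (a ⋆ b) ⋆ d ≗ a ⋆ (b ⋆ d)
  ⋆-assoc a b d zero    = *-assoc _ _ _
  ⋆-assoc a b d (suc n) = begin
    ((shift a ⋆ b ⊕ a ⋆ shift b) ⋆ d) n + ((a ⋆ b) ⋆ shift d) n
      ≈⟨ +-congʳ (⋆-distribʳ-⊕ (shift a ⋆ b) (a ⋆ shift b) d n) ⟩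
    (((shift a ⋆ b) ⋆ d) n + ((a ⋆ shift b) ⋆ d) n) + ((a ⋆ b) ⋆ shift d) n
      ≈⟨ +-cong (+-cong (⋆-assoc (shift a) b d n) (⋆-assoc a (shift b) d n)) (⋆-assoc a b (shift d) n) ⟩
    ((shift a ⋆ (b ⋆ d)) n + (a ⋆ (shift b ⋆ d)) n) + (a ⋆ (b ⋆ shift d)) n
      ≈⟨ +-assoc _ _ _ ⟩
    (shift a ⋆ (b ⋆ d)) n + ((a ⋆ (shift b ⋆ d)) n + (a ⋆ (b ⋆ shift d)) n)
      ≈⟨ +-congˡ (sym (⋆-distribˡ-⊕ a (shift b ⋆ d) (b ⋆ shift d) n)) ⟩
    (shift a ⋆ (b ⋆ d)) n + (a ⋆ (shift b ⋆ d ⊕ b ⋆ shift d)) n ∎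

  ⋆-vanishʳ : ∀ a b n → (∀ m → m ≤ n → b m ≈ 0#) → (a ⋆ b) n ≈ 0#
  ⋆-vanishʳ a b zero    b≈0 = trans (*-congˡ (b≈0 0 z≤n)) (zeroʳ _)
  ⋆-vanishʳ a b (suc n) b≈0 = trans
    (+-cong (⋆-vanishʳ (shift a) b n (λ m m≤n → b≈0 m (ℕ.m≤n⇒m≤1+n m≤n)))
            (⋆-vanishʳ a (shift b) n (λ m m≤n → b≈0 (suc m) (s≤s m≤n))))
    (+-identityʳ 0#)

  ⋆-identityʳ : ∀ a → a ⋆ δ ≗ a
  ⋆-identityʳ a zero    = *-identityʳ _
  ⋆-identityʳ a (suc n) =
    trans (+-cong (⋆-identityʳ (shift a) n) (⋆-vanishʳ a (shift δ) n (λ _ _ → refl))) (+-identityʳ _)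

  -- ν is the Euler operator z d/dz on exponential generating functions.
  ν : Seq → Seq
  ν a m = fromℕ m * a m

  shift-ν : ∀ a → shift (ν a) ≗ ν (shift a) ⊕ shift a
  shift-ν a m = solve 2 (λ k x → (:1 :+ k) :* x := k :* x :+ x) refl (fromℕ m) (a (suc m))

  ν-derivation : ∀ a b → ν a ⋆ b ⊕ a ⋆ ν b ≗ ν (a ⋆ b)
  ν-derivation a b zero    = solve 2 (λ x y → (:0 :* x) :* y :+ x :* (:0 :* y) := :0 :* (x :* y)) refl (a 0) (b 0)
  ν-derivation a b (suc n) = begin
    ((shift (ν a) ⋆ b) n + (ν a ⋆ shift b) n) + ((shift a ⋆ ν b) n + (a ⋆ shift (ν b)) n)
      ≈⟨ +-cong (+-congʳ (trans (⋆-cong (shift-ν a) (λ _ → refl) n) (⋆-distribʳ-⊕ (ν (shift a)) (shift a) b n)))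
                (+-congˡ (trans (⋆-cong (λ _ → refl) (shift-ν b) n) (⋆-distribˡ-⊕ a (ν (shift b)) (shift b) n))) ⟩
    ((A + X) + C′) + (B + (D + Y))
      ≈⟨ solve 6 (λ A B C′ D X Y → ((A :+ X) :+ C′) :+ (B :+ (D :+ Y)) := (A :+ B) :+ (C′ :+ D) :+ (X :+ Y))
                 refl A B C′ D X Y ⟩
    (A + B) + (C′ + D) + (X + Y)
      ≈⟨ +-congʳ (+-cong (ν-derivation (shift a) b n) (ν-derivation a (shift b) n)) ⟩
    fromℕ n * X + fromℕ n * Y + (X + Y)
      ≈⟨ solve 3 (λ k X Y → k :* X :+ k :* Y :+ (X :+ Y) := (:1 :+ k) :* (X :+ Y)) refl (fromℕ n) X Y ⟩
    fromℕ (suc n) * (X + Y) ∎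
    where
    X Y A B C′ D : Carrier
    X = (shift a ⋆ b) n
    Y = (a ⋆ shift b) n
    A = (ν (shift a) ⋆ b) n
    B = (shift a ⋆ ν b) n
    C′ = (ν a ⋆ shift b) n
    D = (a ⋆ ν (shift b)) n

  Σ< : ℕ → Seq → Carrier
  Σ< zero    g = 0#
  Σ< (suc n) g = g 0 + Σ< n (shift g)

  Σ<-cong : ∀ n {g g′} → (∀ k → k < n → g k ≈ g′ k) → Σ< n g ≈ Σ< n g′
  Σ<-cong zero    g≈g′ = refl
  Σ<-cong (suc n) g≈g′ = +-cong (g≈g′ 0 (s≤s z≤n)) (Σ<-cong n (λ k k<n → g≈g′ (suc k) (s≤s k<n)))

  Σ<-snoc : ∀ n g → Σ< (suc n) g ≈ Σ< n g + g n
  Σ<-snoc zero    g = trans (+-identityʳ _) (sym (+-identityˡ _))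
  Σ<-snoc (suc n) g = trans (+-congˡ (Σ<-snoc n (shift g))) (sym (+-assoc _ _ _))

  Σ<-distrib-⊕ : ∀ n g g′ → Σ< n (g ⊕ g′) ≈ Σ< n g + Σ< n g′
  Σ<-distrib-⊕ zero    g g′ = sym (+-identityʳ 0#)
  Σ<-distrib-⊕ (suc n) g g′ = trans (+-congˡ (Σ<-distrib-⊕ n (shift g) (shift g′))) (+-interchange _ _ _ _)

  Σ<-· : ∀ n k g → Σ< n (k · g) ≈ k * Σ< n g
  Σ<-· zero    k g = sym (zeroʳ k)
  Σ<-· (suc n) k g = trans (+-congˡ (Σ<-· n k (shift g))) (sym (distribˡ _ _ _))

  binomialTerm : ℕ → Seq → Seq → Seq
  binomialTerm n a b k = fromℕ (n C k) * (a k * b (n ∸ k))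

  ⋆-binomial : ∀ n a b → (a ⋆ b) n ≈ Σ< (suc n) (binomialTerm n a b)
  ⋆-binomial zero    a b = solve 2 (λ x y → x :* y := (:1 :+ :0) :* (x :* y) :+ :0) refl (a 0) (b 0)
  ⋆-binomial (suc N) a b = begin
    (shift a ⋆ b) N + (a ⋆ shift b) N
      ≈⟨ +-cong (⋆-binomial N (shift a) b) (⋆-binomial N a (shift b)) ⟩
    S₁ + (binomialTerm N a (shift b) 0 + Σ< N (λ k → binomialTerm N a (shift b) (suc k)))
      ≈⟨ +-congˡ (+-congˡ (Σ<-cong N (λ k k<N → *-congˡ (*-congˡ (reflexive (≡.cong b (≡.sym (ℕ.+-∸-assoc 1 k<N)))))))) ⟩
    S₁ + (binomialTerm (suc N) a b 0 + S₂)
      ≈⟨ solve 3 (λ S₁ t S₂ → S₁ :+ (t :+ S₂) := t :+ (S₁ :+ S₂)) refl S₁ _ S₂ ⟩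
    binomialTerm (suc N) a b 0 + (S₁ + S₂)
      ≈⟨ +-congˡ (+-congˡ (sym S₂-extended)) ⟩
    binomialTerm (suc N) a b 0 + (S₁ + Σ< (suc N) (λ k → fromℕ (N C suc k) * t k))
      ≈⟨ +-congˡ (sym (trans (Σ<-cong (suc N) (λ k _ → pascal k))
                             (Σ<-distrib-⊕ (suc N) (binomialTerm N (shift a) b) (λ k → fromℕ (N C suc k) * t k)))) ⟩
    binomialTerm (suc N) a b 0 + Σ< (suc N) (λ k → binomialTerm (suc N) a b (suc k)) ∎
    where
    t : Seq
    t k = a (suc k) * b (N ∸ k)
    S₁ S₂ : Carrier
    S₁ = Σ< (suc N) (binomialTerm N (shift a) b)
    S₂ = Σ< N (λ k → fromℕ (N C suc k) * t k)
    S₂-extended : Σ< (suc N) (λ k → fromℕ (N C suc k) * t k) ≈ S₂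
    S₂-extended = trans (Σ<-snoc N _)
      (trans (+-congˡ (trans (*-congʳ (reflexive (≡.cong fromℕ (k>n⇒nCk≡0 (ℕ.n<1+n N))))) (zeroˡ _)))
             (+-identityʳ _))
    pascal : ∀ k → binomialTerm (suc N) a b (suc k)
                   ≈ binomialTerm N (shift a) b k + fromℕ (N C suc k) * t k
    pascal k = begin
      fromℕ (suc N C suc k) * t k                      ≡⟨ ≡.cong (λ m → fromℕ m * t k) (nCk+nC[k+1]≡[n+1]C[k+1] N k) ⟨
      fromℕ (N C k ℕ.+ N C suc k) * t k                ≈⟨ *-congʳ (fromℕ-+ (N C k) (N C suc k)) ⟩
      (fromℕ (N C k) + fromℕ (N C suc k)) * t k        ≈⟨ distribʳ (t k) _ _ ⟩
      fromℕ (N C k) * t k + fromℕ (N C suc k) * t k    ∎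

  ⋆-ode-vanish : ∀ p z → z 0 ≈ 0# → (∀ n → z (suc n) ≈ (p ⋆ z) n) → ∀ n → z n ≈ 0#
  ⋆-ode-vanish p z z₀≈0 z′≈p⋆z = <-rec (λ n → z n ≈ 0#) step
    where
    step : ∀ n → (∀ {m} → m < n → z m ≈ 0#) → z n ≈ 0#
    step zero    _  = z₀≈0
    step (suc n) ih = trans (z′≈p⋆z n) (⋆-vanishʳ p z n (λ m m≤n → ih (s≤s m≤n)))

module HessenbergDeterminant {c ℓ : Level} (R : CommutativeRing c ℓ) where
  open import Data.Nat as ℕ using (_<_)
  open import Data.Nat.Induction using (<-rec)
  open import Data.Fin as Fin using (Fin; toℕ; punchIn)
  open CommutativeRing R hiding (zero)
  open WithRing R using (det; ΣFin; sign)
  open IntegerCoefficients R using (solve; _:+_; _:*_; _:=_; :-_; :0; :1)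
  open BinomialConvolution R using (Seq; _≗_; Σ<; Σ<-cong; Σ<-distrib-⊕; Σ<-·)
  open import Relation.Binary.Reasoning.Setoid setoid

  Entries : Set c
  Entries = ℕ → ℕ → Carrier

  hessenberg : Entries → Entries
  hessenberg f zero    zero          = f 0 0
  hessenberg f zero    (suc zero)    = - 1#
  hessenberg f zero    (suc (suc j)) = 0#
  hessenberg f (suc i) zero          = f (suc i) 0
  hessenberg f (suc i) (suc j)       = hessenberg (λ i′ j′ → f (suc i′) (suc j′)) i j

  hessenberg-unique : (M : Entries) → (∀ i → M i (suc i) ≈ - 1#) → (∀ i k → M i (suc (suc (i ℕ.+ k))) ≈ 0#) →
                      ∀ i j → M i j ≈ hessenberg M i j
  hessenberg-unique M super upper zero    zero          = refl
  hessenberg-unique M super upper zero    (suc zero)    = super 0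
  hessenberg-unique M super upper zero    (suc (suc k)) = upper 0 k
  hessenberg-unique M super upper (suc i) zero          = refl
  hessenberg-unique M super upper (suc i) (suc j)       =
    hessenberg-unique (λ i′ j′ → M (suc i′) (suc j′)) (λ i → super (suc i)) (λ i → upper (suc i)) i j

  detH : Entries → ℕ → Carrier
  detH f n = det n (λ r s → hessenberg f (toℕ r) (toℕ s))

  ΣFin-cong : ∀ n {g g′ : Fin n → Carrier} → (∀ j → g j ≈ g′ j) → ΣFin n g ≈ ΣFin n g′
  ΣFin-cong zero    g≈g′ = refl
  ΣFin-cong (suc n) g≈g′ = +-cong (g≈g′ Fin.zero) (ΣFin-cong n (λ j → g≈g′ (Fin.suc j)))

  det-cong : ∀ n {M M′ : Fin n → Fin n → Carrier} → (∀ r s → M r s ≈ M′ r s) → det n M ≈ det n M′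
  det-cong zero    M≈M′ = refl
  det-cong (suc n) M≈M′ = ΣFin-cong (suc n) (λ j →
    *-congˡ {sign (toℕ j)} (*-cong (M≈M′ Fin.zero j) (det-cong n (λ r s → M≈M′ (Fin.suc r) (punchIn j s)))))

  minor₀₀ minor₀₁ : Entries → Entries
  minor₀₀ f i j = f (suc i) (suc j)
  minor₀₁ f i zero    = f (suc i) 0
  minor₀₁ f i (suc j) = f (suc i) (suc (suc j))

  detH-expand : ∀ n f → detH f (suc (suc n)) ≈ f 0 0 * detH (minor₀₀ f) (suc n) + detH (minor₀₁ f) (suc n)
  detH-expand n f = begin
    1# * (f 0 0 * detH (minor₀₀ f) (suc n)) + (- 1# * (- 1# * det (suc n) minor) + ΣFin n _)
      ≈⟨ +-congˡ (+-cong (*-congˡ (*-congˡ (det-cong (suc n) minor≈)))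
                         (ΣFin-vanish n (λ j → trans (*-congˡ (zeroˡ _)) (zeroʳ _)))) ⟩
    1# * (f 0 0 * detH (minor₀₀ f) (suc n)) + (- 1# * (- 1# * detH (minor₀₁ f) (suc n)) + 0#)
      ≈⟨ solve 2 (λ a d → :1 :* a :+ ((:- :1) :* ((:- :1) :* d) :+ :0) := a :+ d) refl _ _ ⟩
    f 0 0 * detH (minor₀₀ f) (suc n) + detH (minor₀₁ f) (suc n) ∎
    where
    minor : Fin (suc n) → Fin (suc n) → Carrier
    minor r s = hessenberg f (suc (toℕ r)) (toℕ (punchIn (Fin.suc Fin.zero) s))
    minor≈ : ∀ r s → minor r s ≈ hessenberg (minor₀₁ f) (toℕ r) (toℕ s)
    minor≈ Fin.zero     Fin.zero                = refl
    minor≈ (Fin.suc r)  Fin.zero                = refl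
    minor≈ Fin.zero     (Fin.suc Fin.zero)      = refl
    minor≈ Fin.zero     (Fin.suc (Fin.suc s))   = refl
    minor≈ (Fin.suc r)  (Fin.suc s)             = refl
    ΣFin-vanish : ∀ k {g : Fin k → Carrier} → (∀ j → g j ≈ 0#) → ΣFin k g ≈ 0#
    ΣFin-vanish zero    g≈0 = refl
    ΣFin-vanish (suc k) g≈0 = trans (+-cong (g≈0 Fin.zero) (ΣFin-vanish k (λ j → g≈0 (Fin.suc j)))) (+-identityʳ 0#)

  detH-recurrence : ∀ n f → detH f (suc n) ≈ Σ< (suc n) (λ j → f n j * detH f j)
  detH-recurrence zero    f = +-congʳ (*-identityˡ _)
  detH-recurrence (suc n) f = begin
    detH f (suc (suc n))
      ≈⟨ detH-expand n f ⟩
    f 0 0 * detH (minor₀₀ f) (suc n) + detH (minor₀₁ f) (suc n)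
      ≈⟨ +-cong (*-congˡ (detH-recurrence n (minor₀₀ f))) (detH-recurrence n (minor₀₁ f)) ⟩
    f 0 0 * (row 1 * 1# + Σ< n g₀₀) + (row 0 * 1# + Σ< n g₀₁)
      ≈⟨ solve 5 (λ a r₀ r₁ S T → a :* (r₁ :* :1 :+ S) :+ (r₀ :* :1 :+ T)
                                 := r₀ :* :1 :+ (r₁ :* (a :* :1 :+ :0) :+ (a :* S :+ T))) refl (f 0 0) (row 0) (row 1) _ _ ⟩
    row 0 * 1# + (row 1 * (f 0 0 * 1# + 0#) + (f 0 0 * Σ< n g₀₀ + Σ< n g₀₁))
      ≈⟨ +-congˡ (+-cong (*-congˡ (sym (detH-recurrence zero f))) tail) ⟩
    row 0 * 1# + (row 1 * detH f 1 + Σ< n (λ j → row (suc (suc j)) * detH f (suc (suc j)))) ∎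
    where
    row : ℕ → Carrier
    row = f (suc n)
    g₀₀ g₀₁ : Seq
    g₀₀ j = row (suc (suc j)) * detH (minor₀₀ f) (suc j)
    g₀₁ j = row (suc (suc j)) * detH (minor₀₁ f) (suc j)
    tail : f 0 0 * Σ< n g₀₀ + Σ< n g₀₁ ≈ Σ< n (λ j → row (suc (suc j)) * detH f (suc (suc j)))
    tail = begin
      f 0 0 * Σ< n g₀₀ + Σ< n g₀₁      ≈⟨ +-congʳ (sym (Σ<-· n (f 0 0) g₀₀)) ⟩
      Σ< n _ + Σ< n g₀₁                ≈⟨ sym (Σ<-distrib-⊕ n _ g₀₁) ⟩
      Σ< n _                           ≈⟨ Σ<-cong n (λ j _ → trans
                                            (solve 4 (λ a r d e → a :* (r :* d) :+ r :* e := r :* (a :* d :+ e)) refl (f 0 0) _ _ _)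
                                            (*-congˡ (sym (detH-expand j f)))) ⟩
      Σ< n (λ j → row (suc (suc j)) * detH f (suc (suc j))) ∎

  recurrence-unique : ∀ (f : Entries) {u v : Seq} → u 0 ≈ v 0 →
    (∀ n → u (suc n) ≈ Σ< (suc n) (λ j → f n j * u j)) →
    (∀ n → v (suc n) ≈ Σ< (suc n) (λ j → f n j * v j)) → u ≗ v
  recurrence-unique f {u} {v} u₀≈v₀ u-rec v-rec = <-rec (λ n → u n ≈ v n) step
    where
    step : ∀ n → (∀ {m} → m < n → u m ≈ v m) → u n ≈ v n
    step zero    _  = u₀≈v₀
    step (suc n) ih = trans (u-rec n) (trans (Σ<-cong (suc n) (λ j j<1+n → *-congˡ {f n j} (ih j<1+n))) (sym (v-rec n)))

module StirlingPermutations where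
  open import Data.Nat as ℕ using (_<_; z≤n; s≤s; _≡ᵇ_; _≤ᵇ_; _≟_; _≤?_)
  import Data.Nat.Properties as ℕ
  open import Data.Bool using (Bool; true; false; _∧_; _∨_; not; if_then_else_; T)
  open import Data.Bool.Properties using (T?; T-∧)
  open import Data.Bool.ListAction using (all; any)
  open import Data.List using (List; []; _∷_; _++_; length; map; upTo; filter; concatMap; takeWhile; drop)
  import Data.List.Properties as List
  open import Data.List.Relation.Unary.All as All using (All; []; _∷_)
  import Data.List.Relation.Unary.All.Properties as All
  open import Data.List.Relation.Unary.Any as Any using (here; there)
  open import Data.List.Membership.Propositional using (_∈_; find)
  open import Data.List.Membership.Propositional.Properties
    using (∈-map⁺; ∈-map⁻; ∈-concatMap⁺; ∈-concatMap⁻; ∈-upTo⁺; ∈-upTo⁻; ∈-filter⁺; ∈-filter⁻)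
  open import Data.List.Membership.Propositional.Properties.WithK using (unique∧set⇒bag)
  open import Data.List.Relation.Unary.Unique.Propositional using (Unique; []; _∷_)
  import Data.List.Relation.Unary.Unique.Propositional.Properties as Unique
  open import Data.List.Relation.Binary.Permutation.Propositional using (_↭_)
  open import Data.List.Relation.Binary.BagAndSetEquality using (∼bag⇒↭)
  open import Data.Product using (_×_; _,_; proj₁; proj₂; ∃; ∃₂)
  open import Data.Empty using (⊥; ⊥-elim)
  open import Function.Bundles using (mk⇔; Equivalence)
  open import Relation.Nullary using (¬?; Dec; yes; no)
  open import Relation.Nullary.Decidable using (dec-true; dec-false)
  open import Relation.Binary.PropositionalEquality using (_≡_; _≢_; refl; sym; trans; cong; cong₂; subst; module ≡-Reasoning)

  Unique-concatMap⁺ : ∀ {A B : Set} {f : A → List B} {xs : List A} (g : B → A) →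
    (∀ {x y} → x ∈ xs → y ∈ f x → g y ≡ x) → Unique xs → (∀ {x} → x ∈ xs → Unique (f x)) →
    Unique (concatMap f xs)
  Unique-concatMap⁺ {xs = []}     g g-inv []         f-unique = []
  Unique-concatMap⁺ {f = f} {xs = x ∷ xs} g g-inv (x∉ ∷ xs-unique) f-unique =
    Unique.++⁺ (f-unique (here refl))
               (Unique-concatMap⁺ g (λ x′∈ → g-inv (there x′∈)) xs-unique (λ x′∈ → f-unique (there x′∈)))
               disjoint
    where
    disjoint : ∀ {y} → y ∈ f x × y ∈ concatMap f xs → ⊥
    disjoint (y∈fx , y∈rest) with find (∈-concatMap⁻ f {xs = xs} y∈rest)
    ... | x′ , x′∈ , y∈fx′ = All.lookup x∉ x′∈ (trans (sym (g-inv (here refl) y∈fx)) (g-inv (there x′∈) y∈fx′))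

  letters : ℕ → List ℕ
  letters n = map suc (upTo n)

  Letter : ℕ → ℕ → Set
  Letter n a = 1 ≤ a × a ≤ n

  ∈-letters⁻ : ∀ {n a} → a ∈ letters n → Letter n a
  ∈-letters⁻ a∈ with ∈-map⁻ suc a∈
  ... | _ , a′∈ , refl = s≤s z≤n , ∈-upTo⁻ a′∈

  ∈-letters⁺ : ∀ {n a} → Letter n a → a ∈ letters n
  ∈-letters⁺ {a = suc a} (_ , a≤n) = ∈-map⁺ suc (∈-upTo⁺ a≤n)

  ∈-words⁺ : ∀ k n w → length w ≡ k → All (Letter n) w → w ∈ words k n
  ∈-words⁺ zero    n []      refl []         = here refl
  ∈-words⁺ (suc k) n (a ∷ w) refl (a∈ ∷ w∈) =
    ∈-concatMap⁺ (λ w′ → map (_∷ w′) (letters n))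
      (Any.map (λ { refl → ∈-map⁺ (_∷ w) (∈-letters⁺ a∈) }) (∈-words⁺ k n w refl w∈))

  ∈-words⁻ : ∀ k n w → w ∈ words k n → length w ≡ k × All (Letter n) w
  ∈-words⁻ zero    n w (here refl) = refl , []
  ∈-words⁻ (suc k) n w w∈ with find (∈-concatMap⁻ (λ w′ → map (_∷ w′) (letters n)) {xs = words k n} w∈)
  ... | w′ , w′∈ , a∷w′∈ with ∈-map⁻ (_∷ w′) a∷w′∈
  ... | a , a∈ , refl = cong suc (proj₁ (∈-words⁻ k n w′ w′∈)) , ∈-letters⁻ a∈ ∷ proj₂ (∈-words⁻ k n w′ w′∈)

  words-unique : ∀ k n → Unique (words k n)
  words-unique zero    n = [] ∷ []
  words-unique (suc k) n = Unique-concatMap⁺ (drop 1) tail-inv (words-unique k n)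
    (λ _ → Unique.map⁺ List.∷-injectiveˡ (Unique.map⁺ ℕ.suc-injective (Unique.upTo⁺ n)))
    where
    tail-inv : ∀ {w y} → w ∈ words k n → y ∈ map (_∷ w) (letters n) → drop 1 y ≡ w
    tail-inv _ y∈ with ∈-map⁻ _ y∈
    ... | _ , _ , refl = refl

  record IsStirlingWord (n : ℕ) (w : List ℕ) : Set where
    field
      length≡ : length w ≡ 2 ℕ.* n
      letter  : All (Letter n) w
      twice   : ∀ {i} → Letter n i → occ i w ≡ 2
      gaps    : T (stirlingCond w)

  ∈Q⁻ : ∀ n w → w ∈ Q n → IsStirlingWord n w
  ∈Q⁻ n w w∈ with ∈-filter⁻ (λ w → T? (isStirling n w)) {xs = words (2 ℕ.* n) n} w∈
  ... | w∈words , stirling with ∈-words⁻ (2 ℕ.* n) n w w∈words | Equivalence.to T-∧ stirling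
  ... | length≡ , letter | twice , gaps = record
    { length≡ = length≡
    ; letter  = letter
    ; twice   = λ i∈ → ℕ.≡ᵇ⇒≡ _ 2 (All.lookup (All.all⁺ _ (letters n) twice) (∈-letters⁺ i∈))
    ; gaps    = gaps
    }

  ∈Q⁺ : ∀ n w → IsStirlingWord n w → w ∈ Q n
  ∈Q⁺ n w s = ∈-filter⁺ (λ w → T? (isStirling n w))
    (∈-words⁺ (2 ℕ.* n) n w length≡ letter)
    (Equivalence.from T-∧ (All.all⁻ _ (All.tabulate (λ i∈ → ℕ.≡⇒≡ᵇ _ 2 (twice (∈-letters⁻ i∈)))) , gaps))
    where open IsStirlingWord s

  Q-unique : ∀ n → Unique (Q n)
  Q-unique n = Unique.filter⁺ (λ w → T? (isStirling n w)) (words-unique (2 ℕ.* n) n)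

  ≡ᵇ-refl : ∀ a → (a ≡ᵇ a) ≡ true
  ≡ᵇ-refl a = dec-true (a ≟ a) refl

  ≢⇒≡ᵇ-false : ∀ {a b} → a ≢ b → (a ≡ᵇ b) ≡ false
  ≢⇒≡ᵇ-false {a} {b} = dec-false (a ≟ b)

  occ-absent : ∀ {a u} → All (_≢ a) u → occ a u ≡ 0
  occ-absent             []              = refl
  occ-absent {a} {b ∷ _} (b≢a ∷ u≢a) rewrite ≢⇒≡ᵇ-false (λ a≡b → b≢a (sym a≡b)) = occ-absent u≢a

  occ-zero⇒absent : ∀ a u → occ a u ≡ 0 → All (_≢ a) u
  occ-zero⇒absent a []      _      = []
  occ-zero⇒absent a (b ∷ u) occ≡0 with a ≟ b
  ... | yes refl rewrite ≡ᵇ-refl a = ⊥-elim (ℕ.1+n≢0 occ≡0)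
  ... | no  a≢b  rewrite ≢⇒≡ᵇ-false a≢b = (λ b≡a → a≢b (sym b≡a)) ∷ occ-zero⇒absent a u occ≡0

  occ-inserted-≡ : ∀ a u v → occ a (u ++ a ∷ a ∷ v) ≡ 2 ℕ.+ occ a (u ++ v)
  occ-inserted-≡ a []      v rewrite ≡ᵇ-refl a = refl
  occ-inserted-≡ a (b ∷ u) v with a ≡ᵇ b
  ... | true  = cong suc (occ-inserted-≡ a u v)
  ... | false = occ-inserted-≡ a u v

  occ-inserted-≢ : ∀ {i a} u v → i ≢ a → occ i (u ++ a ∷ a ∷ v) ≡ occ i (u ++ v)
  occ-inserted-≢ {i} {a} []      v i≢a rewrite ≢⇒≡ᵇ-false i≢a = refl
  occ-inserted-≢ {i}     (b ∷ u) v i≢a with i ≡ᵇ b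
  ... | true  = cong suc (occ-inserted-≢ u v i≢a)
  ... | false = occ-inserted-≢ u v i≢a

  length-inserted : ∀ {A : Set} (a : A) u v → length (u ++ a ∷ a ∷ v) ≡ 2 ℕ.+ length (u ++ v)
  length-inserted a []      v = refl
  length-inserted a (b ∷ u) v = cong suc (length-inserted a u v)

  All-inserted⁻ : ∀ {P : ℕ → Set} {a} u v → All P (u ++ a ∷ a ∷ v) → All P (u ++ v)
  All-inserted⁻ u v Ps with All.++⁻ u Ps
  ... | Pu , _ ∷ _ ∷ Pv = All.++⁺ Pu Pv

  All-inserted⁺ : ∀ {P : ℕ → Set} {a} u v → P a → All P (u ++ v) → All P (u ++ a ∷ a ∷ v)
  All-inserted⁺ u v Pa Ps with All.++⁻ u Ps
  ... | Pu , Pv = All.++⁺ Pu (Pa ∷ Pa ∷ Pv)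

  before : ℕ → List ℕ → List ℕ
  before a = takeWhile (λ b → T? (not (a ≡ᵇ b)))

  before-≢ : ∀ {a c} w → a ≢ c → before a (c ∷ w) ≡ c ∷ before a w
  before-≢ w a≢c rewrite ≢⇒≡ᵇ-false a≢c = refl

  gapCondition : ℕ → List ℕ → Bool
  gapCondition a w = if any (a ≡ᵇ_) w then all (a ≤ᵇ_) (before a w) else true

  any-absent : ∀ {a v} → All (_≢ a) v → any (a ≡ᵇ_) v ≡ false
  any-absent             []              = refl
  any-absent {a} {b ∷ _} (b≢a ∷ v≢a) rewrite ≢⇒≡ᵇ-false (λ a≡b → b≢a (sym a≡b)) = any-absent v≢a

  any-inserted : ∀ {b a} u v → b ≢ a → any (b ≡ᵇ_) (u ++ a ∷ a ∷ v) ≡ any (b ≡ᵇ_) (u ++ v)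
  any-inserted []      v b≢a rewrite ≢⇒≡ᵇ-false b≢a = refl
  any-inserted {b} (c ∷ u) v b≢a = cong ((b ≡ᵇ c) ∨_) (any-inserted u v b≢a)

  all-before-inserted : ∀ {b a} u v → b < a →
    all (b ≤ᵇ_) (before b (u ++ a ∷ a ∷ v)) ≡ all (b ≤ᵇ_) (before b (u ++ v))
  all-before-inserted {b} {a} [] v b<a
    rewrite before-≢ (a ∷ v) (ℕ.<⇒≢ b<a) | before-≢ v (ℕ.<⇒≢ b<a) | dec-true (b ≤? a) (ℕ.<⇒≤ b<a) = refl
  all-before-inserted {b} (c ∷ u) v b<a with b ≡ᵇ c
  ... | true  = refl
  ... | false = cong ((b ≤ᵇ c) ∧_) (all-before-inserted u v b<a)

  stirlingCond-inserted : ∀ {a} u v → All (_< a) (u ++ v) → stirlingCond (u ++ a ∷ a ∷ v) ≡ stirlingCond (u ++ v)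
  stirlingCond-inserted {a} [] v v<a
    rewrite ≡ᵇ-refl a | any-absent (All.map (λ b<a → ℕ.<⇒≢ b<a) v<a) = refl
  stirlingCond-inserted (b ∷ u) v (b<a ∷ uv<a) = cong₂ _∧_
    (cong₂ (λ p q → if p then q else true) (any-inserted u v (ℕ.<⇒≢ b<a)) (all-before-inserted u v b<a))
    (stirlingCond-inserted u v uv<a)

  split-first : ∀ a w → occ a w ≢ 0 → ∃₂ λ u v → w ≡ u ++ a ∷ v × All (_≢ a) u
  split-first a []      occ≢0 = ⊥-elim (occ≢0 refl)
  split-first a (b ∷ w) occ≢0 with b ≟ a
  ... | yes refl = [] , w , refl , []
  ... | no  b≢a rewrite ≢⇒≡ᵇ-false (λ a≡b → b≢a (sym a≡b)) with split-first a w occ≢0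
  ...   | u , v , refl , u≢a = b ∷ u , v , refl , b≢a ∷ u≢a

  occ-after-first : ∀ {a} u v → All (_≢ a) u → occ a (u ++ a ∷ v) ≡ suc (occ a v)
  occ-after-first {a} [] v [] rewrite ≡ᵇ-refl a = refl
  occ-after-first {a} (b ∷ u) v (b≢a ∷ u≢a) rewrite ≢⇒≡ᵇ-false (λ a≡b → b≢a (sym a≡b)) = occ-after-first u v u≢a

  occ≢0⇒any : ∀ a w → occ a w ≢ 0 → any (a ≡ᵇ_) w ≡ true
  occ≢0⇒any a []      occ≢0 = ⊥-elim (occ≢0 refl)
  occ≢0⇒any a (b ∷ w) occ≢0 with a ≡ᵇ b
  ... | true  = refl
  ... | false = occ≢0⇒any a w occ≢0

  stirlingCond-suffix : ∀ u v → T (stirlingCond (u ++ v)) → T (stirlingCond v)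
  stirlingCond-suffix []      v sc = sc
  stirlingCond-suffix (a ∷ u) v sc = stirlingCond-suffix u v (proj₂ (Equivalence.to (T-∧ {gapCondition a (u ++ v)}) sc))

  next-is-largest : ∀ M v → occ M v ≡ 1 → All (_≤ M) v → T (gapCondition M v) → ∃ λ v′ → v ≡ M ∷ v′
  next-is-largest M []      () _ _
  next-is-largest M (c ∷ v) occ≡1 (c≤M ∷ _) gap with c ≟ M
  ... | yes refl = v , refl
  ... | no  c≢M rewrite ≢⇒≡ᵇ-false (λ M≡c → c≢M (sym M≡c))
                      | occ≢0⇒any M v (λ occ≡0 → ℕ.1+n≢0 (trans (sym occ≡1) occ≡0)) =
    ⊥-elim (c≢M (ℕ.≤-antisym c≤M (ℕ.≤ᵇ⇒≤ M c (proj₁ (Equivalence.to (T-∧ {M ≤ᵇ c}) gap)))))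

  module _ {m : ℕ} where
    private
      M : ℕ
      M = suc m

    M-letter : Letter M M
    M-letter = s≤s z≤n , ℕ.≤-refl

    letter-lift : ∀ {a} → Letter m a → Letter M a
    letter-lift (1≤a , a≤m) = 1≤a , ℕ.m≤n⇒m≤1+n a≤m

    letter-below : ∀ {a} → Letter m a → a < M
    letter-below (_ , a≤m) = s≤s a≤m

    letter-lower : ∀ {a} → Letter M a → a ≢ M → Letter m a
    letter-lower (1≤a , a≤M) a≢M = 1≤a , ℕ.≤-pred (ℕ.≤∧≢⇒< a≤M a≢M)

    length-2+ : ∀ {n} → n ≡ 2 ℕ.* m → 2 ℕ.+ n ≡ 2 ℕ.* M
    length-2+ refl = sym (ℕ.*-suc 2 m)

    insert-largest⁺ : ∀ u v → IsStirlingWord m (u ++ v) → IsStirlingWord M (u ++ M ∷ M ∷ v)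
    insert-largest⁺ u v s = record
      { length≡ = trans (length-inserted M u v) (length-2+ length≡)
      ; letter  = All-inserted⁺ u v M-letter (All.map letter-lift letter)
      ; twice   = twice′
      ; gaps    = subst T (sym (stirlingCond-inserted u v (All.map letter-below letter))) gaps
      }
      where
      open IsStirlingWord s
      twice′ : ∀ {i} → Letter M i → occ i (u ++ M ∷ M ∷ v) ≡ 2
      twice′ {i} i∈ with i ≟ M
      ... | yes refl = trans (occ-inserted-≡ M u v)
                             (cong (2 ℕ.+_) (occ-absent (All.map (λ a∈ → ℕ.<⇒≢ (letter-below a∈)) letter)))
      ... | no  i≢M  = trans (occ-inserted-≢ u v i≢M) (twice (letter-lower i∈ i≢M))

    insert-largest⁻ : ∀ u v → IsStirlingWord M (u ++ M ∷ M ∷ v) → IsStirlingWord m (u ++ v)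
    insert-largest⁻ u v s = record
      { length≡ = ℕ.suc-injective (ℕ.suc-injective (trans (sym (length-inserted M u v)) (trans length≡ (ℕ.*-suc 2 m))))
      ; letter  = letter′
      ; twice   = λ i∈ → trans (sym (occ-inserted-≢ u v (ℕ.<⇒≢ (letter-below i∈)))) (twice (letter-lift i∈))
      ; gaps    = subst T (stirlingCond-inserted u v (All.map letter-below letter′)) gaps
      }
      where
      open IsStirlingWord s
      M-free : All (_≢ M) (u ++ v)
      M-free = occ-zero⇒absent M (u ++ v) (ℕ.suc-injective (ℕ.suc-injective (trans (sym (occ-inserted-≡ M u v)) (twice M-letter))))
      letter′ : All (Letter m) (u ++ v)
      letter′ = All.zipWith (λ (a∈ , a≢M) → letter-lower a∈ a≢M) (All-inserted⁻ u v letter , M-free)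

  largest-adjacent : ∀ m w → IsStirlingWord (suc m) w → ∃₂ λ u v → w ≡ u ++ suc m ∷ suc m ∷ v
  largest-adjacent m w s with split-first (suc m) w (λ occ≡0 → ℕ.1+n≢0 (trans (sym (twice M-letter)) occ≡0))
    where open IsStirlingWord s
  ... | u , v , refl , u≢M
    with next-is-largest (suc m) v occ≡1 (All.map proj₂ (All.tail (All.++⁻ʳ u letter))) gap
    where
    open IsStirlingWord s
    occ≡1 : occ (suc m) v ≡ 1
    occ≡1 = ℕ.suc-injective (trans (sym (occ-after-first u v u≢M)) (twice M-letter))
    gap : T (gapCondition (suc m) v)
    gap = proj₁ (Equivalence.to (T-∧ {gapCondition (suc m) v}) (stirlingCond-suffix u (suc m ∷ v) gaps))
  ... | v′ , refl = u , v′ , refl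

  insertions : ℕ → List ℕ → List (List ℕ)
  insertions a []      = (a ∷ a ∷ []) ∷ []
  insertions a (b ∷ σ) = (a ∷ a ∷ b ∷ σ) ∷ map (b ∷_) (insertions a σ)

  ∈-insertions⁺ : ∀ a u v → u ++ a ∷ a ∷ v ∈ insertions a (u ++ v)
  ∈-insertions⁺ a []      []      = here refl
  ∈-insertions⁺ a []      (b ∷ v) = here refl
  ∈-insertions⁺ a (b ∷ u) v       = there (∈-map⁺ (b ∷_) (∈-insertions⁺ a u v))

  ∈-insertions⁻ : ∀ a σ {w} → w ∈ insertions a σ → ∃₂ λ u v → σ ≡ u ++ v × w ≡ u ++ a ∷ a ∷ v
  ∈-insertions⁻ a []      (here refl) = [] , [] , refl , refl
  ∈-insertions⁻ a (b ∷ σ) (here refl) = [] , b ∷ σ , refl , refl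
  ∈-insertions⁻ a (b ∷ σ) (there w∈) with ∈-map⁻ (b ∷_) w∈
  ... | w′ , w′∈ , refl with ∈-insertions⁻ a σ w′∈
  ...   | u , v , refl , refl = b ∷ u , v , refl , refl

  insertions-unique : ∀ {a σ} → All (_≢ a) σ → Unique (insertions a σ)
  insertions-unique {σ = []}    []          = [] ∷ []
  insertions-unique {σ = b ∷ σ} (b≢a ∷ σ≢a) =
    All.map⁺ (All.universal (λ _ eq → b≢a (sym (List.∷-injectiveˡ eq))) _)
    ∷ Unique.map⁺ List.∷-injectiveʳ (insertions-unique σ≢a)

  _≢?_ : ∀ b a → Dec (b ≢ a)
  b ≢? a = ¬? (b ≟ a)

  erase : ℕ → List ℕ → List ℕ
  erase a = filter (_≢? a)

  erase-inserted : ∀ {a} u v → All (_≢ a) (u ++ v) → erase a (u ++ a ∷ a ∷ v) ≡ u ++ v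
  erase-inserted {a} u v uv≢a with All.++⁻ u uv≢a
  ... | u≢a , v≢a = begin
    erase a (u ++ a ∷ a ∷ v)              ≡⟨ List.filter-++ (_≢? a) u (a ∷ a ∷ v) ⟩
    erase a u ++ erase a (a ∷ a ∷ v)      ≡⟨ cong₂ _++_ (List.filter-all (_≢? a) u≢a)
                                                       (trans (List.filter-reject (_≢? a) (λ a≢a → a≢a refl))
                                                       (trans (List.filter-reject (_≢? a) (λ a≢a → a≢a refl))
                                                              (List.filter-all (_≢? a) v≢a))) ⟩
    u ++ v                                ∎
    where open ≡-Reasoning

  Q-suc↭ : ∀ m → Q (suc m) ↭ concatMap (insertions (suc m)) (Q m)
  Q-suc↭ m = ∼bag⇒↭ (unique∧set⇒bag (Q-unique (suc m)) unique (mk⇔ (to _) from))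
    where
    M : ℕ
    M = suc m
    M-free : ∀ {σ} → IsStirlingWord m σ → All (_≢ M) σ
    M-free s = All.map (λ a∈ → ℕ.<⇒≢ (letter-below a∈)) (IsStirlingWord.letter s)
    to : ∀ w → w ∈ Q M → w ∈ concatMap (insertions M) (Q m)
    to w w∈ with largest-adjacent m w (∈Q⁻ M w w∈)
    ... | u , v , refl = ∈-concatMap⁺ (insertions M)
          (Any.map (λ { refl → ∈-insertions⁺ M u v }) (∈Q⁺ m (u ++ v) (insert-largest⁻ u v (∈Q⁻ M _ w∈))))
    from : ∀ {w} → w ∈ concatMap (insertions M) (Q m) → w ∈ Q M
    from w∈ with find (∈-concatMap⁻ (insertions M) {xs = Q m} w∈)
    ... | σ , σ∈ , w∈ins with ∈-insertions⁻ M σ w∈ins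
    ...   | u , v , refl , refl = ∈Q⁺ M _ (insert-largest⁺ u v (∈Q⁻ m _ σ∈))
    unique : Unique (concatMap (insertions M) (Q m))
    unique = Unique-concatMap⁺ (erase M) erase-inv (Q-unique m) (λ σ∈ → insertions-unique (M-free (∈Q⁻ m _ σ∈)))
      where
      erase-inv : ∀ {σ w} → σ ∈ Q m → w ∈ insertions M σ → erase M w ≡ σ
      erase-inv {σ} σ∈ w∈ with ∈-insertions⁻ M σ w∈
      ... | u , v , refl , refl = erase-inserted u v (M-free (∈Q⁻ m _ σ∈))

open StirlingPermutations

module ListSums {c ℓ : Level} (R : CommutativeRing c ℓ) where
  open import Data.List using (List; []; _∷_; _++_; map; concatMap)
  open import Data.List.Relation.Unary.Any using (here; there)
  open import Data.List.Membership.Propositional using (_∈_)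
  open import Data.List.Relation.Binary.Permutation.Propositional using (_↭_; ↭⇒↭ₛ′)
  import Data.List.Relation.Binary.Permutation.Propositional.Properties as ↭
  import Relation.Binary.PropositionalEquality as ≡
  open CommutativeRing R
  open WithRing R using (sumR)
  open import Data.List.Relation.Binary.Permutation.Setoid.Properties setoid using (foldr-commMonoid)

  ∑ : ∀ {A : Set} → (A → Carrier) → List A → Carrier
  ∑ f xs = sumR (map f xs)

  module _ {A : Set} where
    ∑-↭ : ∀ (f : A → Carrier) {xs ys} → xs ↭ ys → ∑ f xs ≈ ∑ f ys
    ∑-↭ f xs↭ys = foldr-commMonoid +-isCommutativeMonoid (↭⇒↭ₛ′ isEquivalence (↭.map⁺ f xs↭ys))

    ∑-cong : ∀ {f g : A → Carrier} xs → (∀ {a} → a ∈ xs → f a ≈ g a) → ∑ f xs ≈ ∑ g xs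
    ∑-cong []       f≈g = refl
    ∑-cong (x ∷ xs) f≈g = +-cong (f≈g (here ≡.refl)) (∑-cong xs (λ a∈ → f≈g (there a∈)))

    ∑-++ : ∀ (f : A → Carrier) xs ys → ∑ f (xs ++ ys) ≈ ∑ f xs + ∑ f ys
    ∑-++ f []       ys = sym (+-identityˡ _)
    ∑-++ f (x ∷ xs) ys = trans (+-congˡ (∑-++ f xs ys)) (sym (+-assoc _ _ _))

    ∑-*ˡ : ∀ (f : A → Carrier) a xs → ∑ (λ z → a * f z) xs ≈ a * ∑ f xs
    ∑-*ˡ f a []       = sym (zeroʳ a)
    ∑-*ˡ f a (x ∷ xs) = trans (+-congˡ (∑-*ˡ f a xs)) (sym (distribˡ _ _ _))

    ∑-+ : ∀ (f g : A → Carrier) xs → ∑ (λ z → f z + g z) xs ≈ ∑ f xs + ∑ g xs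
    ∑-+ f g []       = sym (+-identityʳ 0#)
    ∑-+ f g (x ∷ xs) = trans (+-congˡ (∑-+ f g xs)) (+-interchange _ _ _ _)
      where open import Algebra.Properties.CommutativeSemigroup +-commutativeSemigroup
              using () renaming (interchange to +-interchange)

  ∑-concatMap : ∀ {A B : Set} (f : B → Carrier) (g : A → List B) xs → ∑ f (concatMap g xs) ≈ ∑ (λ a → ∑ f (g a)) xs
  ∑-concatMap f g []       = refl
  ∑-concatMap f g (x ∷ xs) = trans (∑-++ f (g x) (concatMap g xs)) (+-congˡ (∑-concatMap f g xs))

module InsertionDescents {c ℓ : Level} (R : CommutativeRing c ℓ) (x : CommutativeRing.Carrier R) where
  open import Data.Nat as ℕ using (_<_; _<ᵇ_; z≤n; s≤s)
  import Data.Nat.Properties as ℕ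
  open import Data.Bool using (true; false; if_then_else_)
  open import Data.List using (List; []; _∷_; _++_; [_]; length; map)
  import Data.List.Properties as List
  open import Data.List.Relation.Unary.All using (All; []; _∷_)
  open import Relation.Nullary using (¬_)
  open import Relation.Nullary.Decidable using (dec-true; dec-false)
  import Relation.Binary.PropositionalEquality as ≡
  open CommutativeRing R hiding (zero)
  open WithRing R using (_^_; fromℕ)
  open IntegerCoefficients R using (solve; _:+_; _:*_; _:-_; _:=_; :0; :1)
  open ListSums R
  open import Relation.Binary.Reasoning.Setoid setoid

  desFrom : ℕ → List ℕ → ℕ
  desFrom p σ = descents (p ∷ σ ++ [ 0 ])

  private
    <ᵇ-false : ∀ {a b} → ¬ a < b → (a <ᵇ b) ≡.≡ false
    <ᵇ-false {a} {b} = dec-false (a ℕ.<? b)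

  desFrom-pair : ∀ {p b M} σ → p < M → b < M → desFrom p (M ∷ M ∷ b ∷ σ) ≡.≡ suc (desFrom b σ)
  desFrom-pair {p} {b} {M} σ p<M b<M
    rewrite <ᵇ-false (ℕ.<⇒≯ p<M) | <ᵇ-false {M} {M} (ℕ.<-irrefl ≡.refl) | dec-true (b ℕ.<? M) b<M = ≡.refl

  descentWeight : ℕ → ℕ → Carrier
  descentWeight gaps d = x * (fromℕ gaps * x ^ d) + (1# - x) * (fromℕ d * x ^ d)

  -- Of the length σ + 1 gaps of p σ 0, the desFrom p σ descents keep the descent number
  -- when M M is inserted there, and every other gap gains one descent.
  ∑-insertions : ∀ {M} p σ → p < M → All (_< M) σ →
    ∑ (λ w → x ^ desFrom p w) (insertions M σ) ≈ descentWeight (suc (length σ)) (desFrom p σ)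
  ∑-insertions {M} zero [] p<M []
    rewrite <ᵇ-false {M} {M} (ℕ.<-irrefl ≡.refl) | dec-true (0 ℕ.<? M) p<M =
    solve 1 (λ x → x :* :1 :+ :0 := x :* ((:1 :+ :0) :* :1) :+ (:1 :- x) :* (:0 :* :1)) refl x
  ∑-insertions {M} (suc p) [] p<M []
    rewrite <ᵇ-false {M} {M} (ℕ.<-irrefl ≡.refl) | <ᵇ-false (ℕ.<⇒≯ p<M) | dec-true (0 ℕ.<? M) (ℕ.≤-trans (s≤s z≤n) p<M) =
    solve 1 (λ x → x :* :1 :+ :0 := x :* ((:1 :+ :0) :* (x :* :1)) :+ (:1 :- x) :* ((:1 :+ :0) :* (x :* :1))) refl x
  ∑-insertions {M} p (b ∷ σ) p<M (b<M ∷ σ<M) = begin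
    x ^ desFrom p (M ∷ M ∷ b ∷ σ) + ∑ (λ w → x ^ desFrom p w) (map (b ∷_) (insertions M σ))
      ≡⟨ ≡.cong₂ _+_ (≡.cong (x ^_) (desFrom-pair σ p<M b<M)) (≡.cong sumR (≡.sym (List.map-∘ (insertions M σ)))) ⟩
    x * x ^ desFrom b σ + ∑ (λ w → x ^ desFrom p (b ∷ w)) (insertions M σ)
      ≈⟨ step (b <ᵇ p) ⟩
    descentWeight (suc (suc (length σ))) (desFrom p (b ∷ σ)) ∎
    where
    open WithRing R using (sumR)
    e : ℕ
    e = desFrom b σ
    n : Carrier
    n = fromℕ (length σ)
    step : ∀ t → let [b<p] = if t then 1 else 0 in
      x * x ^ e + ∑ (λ w → x ^ ([b<p] ℕ.+ desFrom b w)) (insertions M σ)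
        ≈ descentWeight (suc (suc (length σ))) ([b<p] ℕ.+ e)
    step true = begin
      x * x ^ e + ∑ (λ w → x * x ^ desFrom b w) (insertions M σ)
        ≈⟨ +-congˡ (trans (∑-*ˡ _ x (insertions M σ)) (*-congˡ (∑-insertions b σ b<M σ<M))) ⟩
      x * x ^ e + x * descentWeight (suc (length σ)) e
        ≈⟨ solve 4 (λ x n f P → x :* P :+ x :* (x :* ((:1 :+ n) :* P) :+ (:1 :- x) :* (f :* P))
                       := x :* ((:1 :+ (:1 :+ n)) :* (x :* P)) :+ (:1 :- x) :* ((:1 :+ f) :* (x :* P))) refl x n (fromℕ e) (x ^ e) ⟩
      descentWeight (suc (suc (length σ))) (suc e) ∎
    step false = begin
      x * x ^ e + ∑ (λ w → x ^ desFrom b w) (insertions M σ)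
        ≈⟨ +-congˡ (∑-insertions b σ b<M σ<M) ⟩
      x * x ^ e + descentWeight (suc (length σ)) e
        ≈⟨ solve 4 (λ x n f P → x :* P :+ (x :* ((:1 :+ n) :* P) :+ (:1 :- x) :* (f :* P))
                       := x :* ((:1 :+ (:1 :+ n)) :* P) :+ (:1 :- x) :* (f :* P)) refl x n (fromℕ e) (x ^ e) ⟩
      descentWeight (suc (suc (length σ))) e ∎

module EulerianRecurrence {c ℓ : Level} (R : CommutativeRing c ℓ) where
  open import Data.Nat as ℕ using (z≤n; s≤s)
  open import Data.List using (List; []; _∷_; map; concatMap)
  import Data.List.Relation.Unary.All as All
  open import Data.List.Membership.Propositional using (_∈_)
  open import Data.Product using (_×_; proj₁)
  import Relation.Binary.PropositionalEquality as ≡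
  open CommutativeRing R hiding (zero)
  open WithRing R using (_^_; fromℕ; Cₙ)
  open IntegerCoefficients R using (solve; _:+_; _:*_; _:-_; _:=_; :0; :1)
  open ListSums R
  open DualNumbers R using (R[ε])
  module Rε = WithRing R[ε]
  open import Relation.Binary.Reasoning.Setoid setoid

  -- Cₙ (x + x ε) = Cₙ x + x Cₙ′(x) ε in R[ε], so xC′ x n is x times the derivative of Cₙ.
  xC′ : Carrier → ℕ → Carrier
  xC′ x n = proj₂ (Rε.Cₙ (x , x) n)

  module _ (x : Carrier) where
    re-^ : ∀ d → proj₁ ((x , x) Rε.^ d) ≈ x ^ d
    re-^ zero    = refl
    re-^ (suc d) = *-congˡ (re-^ d)

    ε-^ : ∀ d → proj₂ ((x , x) Rε.^ d) ≈ fromℕ d * x ^ d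
    ε-^ zero    = sym (zeroˡ _)
    ε-^ (suc d) = begin
      x * proj₂ ((x , x) Rε.^ d) + x * proj₁ ((x , x) Rε.^ d)
        ≈⟨ +-cong (*-congˡ (ε-^ d)) (*-congˡ (re-^ d)) ⟩
      x * (fromℕ d * x ^ d) + x * x ^ d
        ≈⟨ solve 3 (λ x f p → x :* (f :* p) :+ x :* p := (:1 :+ f) :* (x :* p)) refl x (fromℕ d) (x ^ d) ⟩
      (1# + fromℕ d) * (x * x ^ d) ∎

    re-∑ : ∀ {A : Set} (g : A → Carrier × Carrier) xs → proj₁ (Rε.sumR (map g xs)) ≈ ∑ (λ a → proj₁ (g a)) xs
    re-∑ g []       = refl
    re-∑ g (a ∷ xs) = +-congˡ (re-∑ g xs)

    ε-∑ : ∀ {A : Set} (g : A → Carrier × Carrier) xs → proj₂ (Rε.sumR (map g xs)) ≈ ∑ (λ a → proj₂ (g a)) xs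
    ε-∑ g []       = refl
    ε-∑ g (a ∷ xs) = +-congˡ (ε-∑ g xs)

    re-Cₙ : ∀ n → proj₁ (Rε.Cₙ (x , x) n) ≈ Cₙ x n
    re-Cₙ zero    = refl
    re-Cₙ (suc n) = trans (re-∑ _ (Q (suc n))) (∑-cong (Q (suc n)) (λ {σ} _ → re-^ (des σ)))

    xC′-suc : ∀ n → xC′ x (suc n) ≈ ∑ (λ σ → fromℕ (des σ) * x ^ des σ) (Q (suc n))
    xC′-suc n = trans (ε-∑ _ (Q (suc n))) (∑-cong (Q (suc n)) (λ {σ} _ → ε-^ (des σ)))

  Cₙ-recurrence : ∀ x m → Cₙ x (suc m) ≈ x * (fromℕ (suc (2 ℕ.* m)) * Cₙ x m) + (1# - x) * xC′ x m
  Cₙ-recurrence x zero = solve 1 (λ x → x :* :1 :+ :0 := x :* ((:1 :+ :0) :* :1) :+ (:1 :- x) :* :0) refl x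
  Cₙ-recurrence x m@(suc m′) = begin
    ∑ f (Q (suc m))
      ≈⟨ ∑-↭ f (Q-suc↭ m) ⟩
    ∑ f (concatMap (insertions (suc m)) (Q m))
      ≈⟨ ∑-concatMap f (insertions (suc m)) (Q m) ⟩
    ∑ (λ σ → ∑ f (insertions (suc m) σ)) (Q m)
      ≈⟨ ∑-cong (Q m) ∑-insertions-Q ⟩
    ∑ (λ σ → x * (gaps * x ^ des σ) + (1# - x) * (fromℕ (des σ) * x ^ des σ)) (Q m)
      ≈⟨ ∑-+ _ _ (Q m) ⟩
    ∑ (λ σ → x * (gaps * x ^ des σ)) (Q m) + ∑ (λ σ → (1# - x) * (fromℕ (des σ) * x ^ des σ)) (Q m)
      ≈⟨ +-cong (trans (∑-*ˡ _ x (Q m)) (*-congˡ (∑-*ˡ f gaps (Q m))))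
                (trans (∑-*ˡ _ (1# - x) (Q m)) (*-congˡ (sym (xC′-suc x m′)))) ⟩
    x * (gaps * Cₙ x m) + (1# - x) * xC′ x m ∎
    where
    open InsertionDescents R x using (descentWeight; ∑-insertions)
    f : List ℕ → Carrier
    f σ = x ^ des σ
    gaps : Carrier
    gaps = fromℕ (suc (2 ℕ.* m))
    ∑-insertions-Q : ∀ {σ} → σ ∈ Q m → ∑ f (insertions (suc m) σ) ≈ descentWeight (suc (2 ℕ.* m)) (des σ)
    ∑-insertions-Q {σ} σ∈ with ∈Q⁻ m σ σ∈
    ... | s = ≡.subst (λ l → ∑ f (insertions (suc m) σ) ≈ descentWeight (suc l) (des σ)) length≡
                (∑-insertions 0 σ (s≤s z≤n) (All.map letter-below letter))
      where open IsStirlingWord s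

module DualConvolution {c ℓ : Level} (R : CommutativeRing c ℓ) where
  open import Data.Product using (proj₁; proj₂)
  open CommutativeRing R
  open BinomialConvolution R
  open DualNumbers R using (R[ε])
  module ε = BinomialConvolution R[ε]
  open import Relation.Binary.Reasoning.Setoid setoid
  open import Algebra.Properties.CommutativeSemigroup +-commutativeSemigroup
    using () renaming (interchange to +-interchange)

  re ε-part : ε.Seq → Seq
  re    a n = proj₁ (a n)
  ε-part a n = proj₂ (a n)

  re-⋆ : ∀ a b → re (a ε.⋆ b) ≗ re a ⋆ re b
  re-⋆ a b zero    = refl
  re-⋆ a b (suc n) = +-cong (re-⋆ (ε.shift a) b n) (re-⋆ a (ε.shift b) n)

  ε-⋆ : ∀ a b → ε-part (a ε.⋆ b) ≗ ε-part a ⋆ re b ⊕ re a ⋆ ε-part b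
  ε-⋆ a b zero    = +-comm _ _
  ε-⋆ a b (suc n) = trans (+-cong (ε-⋆ (ε.shift a) b n) (ε-⋆ a (ε.shift b) n)) (+-interchange _ _ _ _)

module EulerianOperator {c ℓ : Level} (R : CommutativeRing c ℓ) (x : CommutativeRing.Carrier R) where
  import Data.Nat as ℕ
  import Data.Nat.Properties as ℕ
  import Relation.Binary.PropositionalEquality as ≡
  open CommutativeRing R hiding (zero)
  open WithRing R using (fromℕ)
  open IntegerCoefficients R using (solve; _:+_; _:*_; _:-_; _:=_; :0; :1; fromℕ-+)
  open BinomialConvolution R
  open import Relation.Binary.Reasoning.Setoid setoid

  odd : Seq
  odd m = fromℕ (suc (2 ℕ.* m))

  odd≈ : ∀ m → odd m ≈ 1# + (fromℕ m + fromℕ m)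
  odd≈ m = +-congˡ (trans (fromℕ-+ m (m ℕ.+ 0)) (+-congˡ (reflexive (≡.cong fromℕ (ℕ.+-identityʳ m)))))

  W : Seq → Seq
  W a m = odd m * a m

  W-leibniz : ∀ a b → W a ⋆ b ⊕ a ⋆ W b ≗ W (a ⋆ b) ⊕ a ⋆ b
  W-leibniz a b n = begin
    (W a ⋆ b) n + (a ⋆ W b) n
      ≈⟨ +-cong (trans (⋆-cong W≗ (λ _ → refl) n) (⋆-distribʳ-⊕ a (ν a ⊕ ν a) b n))
                (trans (⋆-cong (λ _ → refl) W≗ n) (⋆-distribˡ-⊕ a b (ν b ⊕ ν b) n)) ⟩
    ((a ⋆ b) n + ((ν a ⊕ ν a) ⋆ b) n) + ((a ⋆ b) n + (a ⋆ (ν b ⊕ ν b)) n)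
      ≈⟨ +-cong (+-congˡ (⋆-distribʳ-⊕ (ν a) (ν a) b n)) (+-congˡ (⋆-distribˡ-⊕ a (ν b) (ν b) n)) ⟩
    (P + (A + A)) + (P + (B + B))
      ≈⟨ solve 3 (λ P A B → (P :+ (A :+ A)) :+ (P :+ (B :+ B)) := (P :+ P) :+ ((A :+ B) :+ (A :+ B))) refl P A B ⟩
    (P + P) + ((A + B) + (A + B))
      ≈⟨ +-congˡ (+-cong (ν-derivation a b n) (ν-derivation a b n)) ⟩
    (P + P) + (fromℕ n * P + fromℕ n * P)
      ≈⟨ solve 2 (λ k P → (P :+ P) :+ (k :* P :+ k :* P) := (:1 :+ (k :+ k)) :* P :+ P) refl (fromℕ n) P ⟩
    (1# + (fromℕ n + fromℕ n)) * P + P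
      ≈⟨ +-congʳ (*-congʳ (sym (odd≈ n))) ⟩
    W (a ⋆ b) n + P ∎
    where
    P A B : Carrier
    P = (a ⋆ b) n
    A = (ν a ⋆ b) n
    B = (a ⋆ ν b) n
    W≗ : ∀ {s} → W s ≗ s ⊕ (ν s ⊕ ν s)
    W≗ {s} m = trans (*-congʳ (odd≈ m)) (solve 2 (λ k y → (:1 :+ (k :+ k)) :* y := y :+ (k :* y :+ k :* y)) refl (fromℕ m) (s m))

  -- For the exponential generating functions A of a and B of a′, Eulerian α a a′ says
  -- A′ = x (2 z A′ + (1 + α) A) + (1 − x) B.
  Eulerian : Carrier → Seq → Seq → Set ℓ
  Eulerian α a a′ = shift a ≗ x · (W a ⊕ α · a) ⊕ (1# - x) · a′

  Eulerian-⋆ : ∀ {α β a a′ b b′} → Eulerian α a a′ → Eulerian β b b′ →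
               Eulerian (1# + α + β) (a ⋆ b) (a′ ⋆ b ⊕ a ⋆ b′)
  Eulerian-⋆ {α} {β} {a} {a′} {b} {b′} a-eul b-eul n = begin
    (shift a ⋆ b) n + (a ⋆ shift b) n
      ≈⟨ +-cong (⋆-linearˡ x (W a ⊕ α · a) (1# - x) a′ b a-eul n) (⋆-linearʳ a x (W b ⊕ β · b) (1# - x) b′ b-eul n) ⟩
    (x * ((W a ⊕ α · a) ⋆ b) n + (1# - x) * (a′ ⋆ b) n) + (x * (a ⋆ (W b ⊕ β · b)) n + (1# - x) * (a ⋆ b′) n)
      ≈⟨ +-cong (+-congʳ (*-congˡ (trans (⋆-distribʳ-⊕ (W a) (α · a) b n) (+-congˡ (⋆-assocˡ-· α a b n)))))
                (+-congʳ (*-congˡ (trans (⋆-distribˡ-⊕ a (W b) (β · b) n) (+-congˡ (⋆-assocʳ-· β a b n))))) ⟩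
    (x * (A + α * P) + (1# - x) * A′) + (x * (B + β * P) + (1# - x) * B′)
      ≈⟨ solve 8 (λ x α β A B P A′ B′ → (x :* (A :+ α :* P) :+ (:1 :- x) :* A′) :+ (x :* (B :+ β :* P) :+ (:1 :- x) :* B′)
                   := x :* ((A :+ B) :+ (α :+ β) :* P) :+ (:1 :- x) :* (A′ :+ B′)) refl x α β A B P A′ B′ ⟩
    x * ((A + B) + (α + β) * P) + (1# - x) * (A′ + B′)
      ≈⟨ +-congʳ (*-congˡ (+-congʳ (W-leibniz a b n))) ⟩
    x * ((W (a ⋆ b) n + P) + (α + β) * P) + (1# - x) * (A′ + B′)
      ≈⟨ solve 7 (λ x α β w P A′ B′ → x :* ((w :+ P) :+ (α :+ β) :* P) :+ (:1 :- x) :* (A′ :+ B′)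
                   := x :* (w :+ (:1 :+ α :+ β) :* P) :+ (:1 :- x) :* (A′ :+ B′)) refl x α β (W (a ⋆ b) n) P _ _ ⟩
    x * (W (a ⋆ b) n + (1# + α + β) * P) + (1# - x) * ((a′ ⋆ b) n + (a ⋆ b′) n) ∎
    where
    P A B A′ B′ : Carrier
    P = (a ⋆ b) n
    A = (W a ⋆ b) n
    B = (a ⋆ W b) n
    A′ = (a′ ⋆ b) n
    B′ = (a ⋆ b′) n

module EulerianEgf {c ℓ : Level} (R : CommutativeRing c ℓ) (x : CommutativeRing.Carrier R) where
  open CommutativeRing R hiding (zero)
  open WithRing R using (Cₙ)
  open IntegerCoefficients R using (solve; _:+_; _:*_; _:-_; _:=_; :0; :1)
  open BinomialConvolution R
  open EulerianOperator R x public
  open EulerianRecurrence R using (xC′; Cₙ-recurrence)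

  Cₓ θ K θK : Seq
  Cₓ = Cₙ x
  θ = xC′ x
  K zero    = x
  K (suc m) = Cₓ (suc m)
  θK zero    = x
  θK (suc m) = θ (suc m)

  Cₓ-eulerian : Eulerian 0# Cₓ θ
  Cₓ-eulerian m = trans (Cₙ-recurrence x m)
    (solve 4 (λ x w c t → x :* w :+ (:1 :- x) :* t := x :* (w :+ :0 :* c) :+ (:1 :- x) :* t) refl x (W Cₓ m) (Cₓ m) (θ m))

  K-eulerian : Eulerian 0# K θK
  K-eulerian zero    = trans (Cₙ-recurrence x 0)
    (solve 1 (λ x → x :* ((:1 :+ :0) :* :1) :+ (:1 :- x) :* :0 := x :* ((:1 :+ :0) :* x :+ :0 :* x) :+ (:1 :- x) :* x) refl x)
  K-eulerian (suc m) = Cₓ-eulerian (suc m)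

  T Θ : Seq
  T = Cₓ ⋆ Cₓ ⋆ K
  Θ = (θ ⋆ Cₓ ⊕ Cₓ ⋆ θ) ⋆ K ⊕ (Cₓ ⋆ Cₓ) ⋆ θK

  T-eulerian : Eulerian (1# + (1# + 0# + 0#) + 0#) T Θ
  T-eulerian = Eulerian-⋆ (Eulerian-⋆ Cₓ-eulerian Cₓ-eulerian) K-eulerian

-- The induction runs over all rings at once: the step in R needs the hypothesis in R[ε].
Cₓ-ode : ∀ {c ℓ} (R : CommutativeRing c ℓ) x n → let open EulerianEgf R x in
        CommutativeRing._≈_ R (Cₓ (suc n)) (T n)
Cₓ-ode R x zero = solve 1 (λ x → x :* :1 :+ :0 := (:1 :* :1) :* x) refl x
  where open CommutativeRing R using (refl)
        open IntegerCoefficients R using (solve; _:+_; _:*_; _:=_; :0; :1)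
Cₓ-ode R x (suc n) = begin
  Cₓ (suc (suc n))                                             ≈⟨ Cₓ-eulerian (suc n) ⟩
  x * (W Cₓ (suc n) + 0# * Cₓ (suc n)) + (1# - x) * θ (suc n)  ≈⟨ +-cong (*-congˡ weights) (*-congˡ θ-step) ⟩
  x * (W T n + α * T n) + (1# - x) * Θ n                       ≈⟨ sym (T-eulerian n) ⟩
  T (suc n)                                                    ∎
  where
  open CommutativeRing R hiding (zero)
  open WithRing R using (fromℕ)
  open IntegerCoefficients R using (solve; _:+_; _:*_; _:-_; _:=_; :0; :1)
  open EulerianEgf R x
  open BinomialConvolution R using (_≗_; ⋆-cong; _⊕_; _⋆_)
  open DualNumbers R using (R[ε])
  open DualConvolution R using (re; ε-part; re-⋆; ε-⋆)
  open EulerianRecurrence R using (re-Cₙ)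
  open import Relation.Binary.Reasoning.Setoid setoid
  module ε = EulerianEgf R[ε] (x , x)
  module Rε = BinomialConvolution R[ε]
  α : Carrier
  α = 1# + (1# + 0# + 0#) + 0#
  weights : W Cₓ (suc n) + 0# * Cₓ (suc n) ≈ W T n + α * T n
  weights = begin
    odd (suc n) * Cₓ (suc n) + 0# * Cₓ (suc n)
      ≈⟨ +-cong (*-cong (odd≈ (suc n)) IH) (*-congˡ IH) ⟩
    (1# + ((1# + fromℕ n) + (1# + fromℕ n))) * T n + 0# * T n
      ≈⟨ solve 2 (λ k t → (:1 :+ ((:1 :+ k) :+ (:1 :+ k))) :* t :+ :0 :* t
                        := (:1 :+ (k :+ k)) :* t :+ (:1 :+ (:1 :+ :0 :+ :0) :+ :0) :* t) refl (fromℕ n) (T n) ⟩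
    (1# + (fromℕ n + fromℕ n)) * T n + α * T n
      ≈⟨ +-congʳ (*-congʳ (sym (odd≈ n))) ⟩
    W T n + α * T n ∎
    where
    IH : Cₓ (suc n) ≈ T n
    IH = Cₓ-ode R x n
  re-Cₓ : re ε.Cₓ ≗ Cₓ
  re-Cₓ = re-Cₙ x
  θ-step : θ (suc n) ≈ Θ n
  θ-step = begin
    θ (suc n)
      ≈⟨ proj₂ (Cₓ-ode R[ε] (x , x) n) ⟩
    ε-part (ε.Cₓ Rε.⋆ ε.Cₓ Rε.⋆ ε.K) n
      ≈⟨ ε-⋆ (ε.Cₓ Rε.⋆ ε.Cₓ) ε.K n ⟩
    (ε-part (ε.Cₓ Rε.⋆ ε.Cₓ) ⋆ re ε.K) n + (re (ε.Cₓ Rε.⋆ ε.Cₓ) ⋆ ε-part ε.K) n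
      ≈⟨ +-cong (⋆-cong (λ m → trans (ε-⋆ ε.Cₓ ε.Cₓ m)
                                      (+-cong (⋆-cong (λ _ → refl) re-Cₓ m) (⋆-cong re-Cₓ (λ _ → refl) m))) re-K n)
                (⋆-cong (λ m → trans (re-⋆ ε.Cₓ ε.Cₓ m) (⋆-cong re-Cₓ re-Cₓ m)) ε-K n) ⟩
    Θ n ∎
    where
    re-K : re ε.K ≗ K
    re-K zero    = refl
    re-K (suc m) = re-Cₓ (suc m)
    ε-K : ε-part ε.K ≗ θK
    ε-K zero    = refl
    ε-K (suc m) = refl

module HessenbergEntries {c ℓ : Level} (R : CommutativeRing c ℓ) (x : CommutativeRing.Carrier R) where
  open import Data.Nat as ℕ using (_<_; _∸_; _≟_; _<?_)
  import Data.Nat.Properties as ℕ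
  open import Data.Nat.Combinatorics using (_C_)
  open import Relation.Nullary.Decidable using (dec-true; dec-false)
  import Relation.Binary.PropositionalEquality as ≡
  open CommutativeRing R using (Carrier; _≈_; refl; -_; 1#; 0#; _*_)
  open WithRing R using (h; fromℕ; Cₙ)

  h-below : ∀ {n j} → j < n → h x (suc n) (suc j) ≡.≡ fromℕ (suc n C j) * Cₙ x (n ∸ j)
  h-below {n} {j} j<n rewrite dec-true (j <? n) j<n = ≡.refl

  h-diagonal : ∀ n → h x (suc n) (suc n) ≡.≡ fromℕ (suc n C n) * x
  h-diagonal n rewrite dec-false (n <? n) (ℕ.<-irrefl ≡.refl) | dec-true (n ≟ n) ≡.refl = ≡.refl

  entries : ℕ → ℕ → Carrier
  entries i j = h x (suc i) (suc j)

  entries-super : ∀ i → entries i (suc i) ≈ - 1#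
  entries-super i rewrite dec-false (suc i <? i) (ℕ.<-asym (ℕ.n<1+n i)) | dec-false (suc i ≟ i) ℕ.1+n≢n
                        | dec-true (i ≟ i) ≡.refl = refl

  entries-upper : ∀ i k → entries i (suc (suc (i ℕ.+ k))) ≈ 0#
  entries-upper i k
    rewrite dec-false (suc (suc (i ℕ.+ k)) <? i) (ℕ.<-asym (ℕ.m<n⇒m<1+n (ℕ.s≤s (ℕ.m≤m+n i k))))
          | dec-false (suc (suc (i ℕ.+ k)) ≟ i) (λ eq → ℕ.<-irrefl (≡.sym eq) (ℕ.m<n⇒m<1+n (ℕ.s≤s (ℕ.m≤m+n i k))))
          | dec-false (suc (i ℕ.+ k) ≟ i) (λ eq → ℕ.<-irrefl (≡.sym eq) (ℕ.s≤s (ℕ.m≤m+n i k))) = refl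

module EulerianReciprocal {c ℓ : Level} (R : CommutativeRing c ℓ) (x : CommutativeRing.Carrier R) where
  open import Data.Nat as ℕ using (_<_; _∸_)
  import Data.Nat.Properties as ℕ
  open import Data.Nat.Combinatorics using (_C_; nCn≡1)
  import Relation.Binary.PropositionalEquality as ≡
  open import Data.Sum using (inj₁; inj₂)
  open CommutativeRing R hiding (zero)
  open WithRing R using (h; fromℕ)
  open IntegerCoefficients R using (solve; _:+_; _:*_; _:-_; :-_; _:=_; :0; :1)
  open BinomialConvolution R
  open EulerianEgf R x using (Cₓ; K; T)
  open HessenbergEntries R x
  open import Relation.Binary.Reasoning.Setoid setoid

  -- The exponential generating function 1 + (1 − x) z − ∫₀ᶻ C.
  E : Seq
  E zero          = 1#
  E (suc zero)    = - x
  E (suc (suc m)) = - Cₓ (suc m)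

  shift-E : shift E ≗ (- 1#) · Cₓ ⊕ (1# - x) · δ
  shift-E zero    = solve 1 (λ x → :- x := (:- :1) :* :1 :+ (:1 :- x) :* :1) refl x
  shift-E (suc m) = solve 2 (λ x c → :- c := (:- :1) :* c :+ (:1 :- x) :* :0) refl x (Cₓ (suc m))

  K≗ : K ≗ 1# · Cₓ ⊕ (x - 1#) · δ
  K≗ zero    = solve 1 (λ x → x := :1 :* :1 :+ (x :- :1) :* :1) refl x
  K≗ (suc m) = solve 2 (λ x c → c := :1 :* c :+ (x :- :1) :* :0) refl x (Cₓ (suc m))

  T⋆E≗ : T ⋆ E ≗ (Cₓ ⋆ K) ⋆ (Cₓ ⋆ E)
  T⋆E≗ n = begin
    ((Cₓ ⋆ Cₓ ⋆ K) ⋆ E) n      ≈⟨ ⋆-assoc (Cₓ ⋆ Cₓ) K E n ⟩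
    ((Cₓ ⋆ Cₓ) ⋆ (K ⋆ E)) n    ≈⟨ ⋆-assoc Cₓ Cₓ (K ⋆ E) n ⟩
    (Cₓ ⋆ (Cₓ ⋆ (K ⋆ E))) n    ≈⟨ ⋆-cong (λ _ → refl) swap n ⟩
    (Cₓ ⋆ (K ⋆ (Cₓ ⋆ E))) n    ≈⟨ ⋆-assoc Cₓ K (Cₓ ⋆ E) n ⟨
    ((Cₓ ⋆ K) ⋆ (Cₓ ⋆ E)) n    ∎
    where
    swap : Cₓ ⋆ (K ⋆ E) ≗ K ⋆ (Cₓ ⋆ E)
    swap m = trans (sym (⋆-assoc Cₓ K E m)) (trans (⋆-cong (⋆-comm Cₓ K) (λ _ → refl) m) (⋆-assoc K Cₓ E m))

  Cₓ⋆E-step : ∀ n → (Cₓ ⋆ E) (suc n) ≈ ((Cₓ ⋆ K) ⋆ (Cₓ ⋆ E ⊕ (- 1#) · δ)) n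
  Cₓ⋆E-step n = begin
    (shift Cₓ ⋆ E) n + (Cₓ ⋆ shift E) n
      ≈⟨ +-cong (trans (⋆-cong (Cₓ-ode R x) (λ _ → refl) n) (T⋆E≗ n))
                (trans (⋆-linearʳ Cₓ (- 1#) Cₓ (1# - x) δ shift-E n) (+-congˡ (*-congˡ (⋆-identityʳ Cₓ n)))) ⟩
    J + ((- 1#) * (Cₓ ⋆ Cₓ) n + (1# - x) * Cₓ n)
      ≈⟨ solve 4 (λ x J P c → J :+ ((:- :1) :* P :+ (:1 :- x) :* c) := :1 :* J :+ (:- :1) :* (:1 :* P :+ (x :- :1) :* c)) refl x J _ _ ⟩
    1# * J + (- 1#) * (1# * (Cₓ ⋆ Cₓ) n + (x - 1#) * Cₓ n)
      ≈⟨ +-congˡ (*-congˡ (sym (trans (⋆-linearʳ Cₓ 1# Cₓ (x - 1#) δ K≗ n) (+-congˡ (*-congˡ (⋆-identityʳ Cₓ n)))))) ⟩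
    1# * J + (- 1#) * (Cₓ ⋆ K) n
      ≈⟨ +-congˡ (*-congˡ (sym (⋆-identityʳ (Cₓ ⋆ K) n))) ⟩
    1# * J + (- 1#) * ((Cₓ ⋆ K) ⋆ δ) n
      ≈⟨ sym (⋆-linearʳ (Cₓ ⋆ K) 1# (Cₓ ⋆ E) (- 1#) δ (λ m → +-congʳ (sym (*-identityˡ _))) n) ⟩
    ((Cₓ ⋆ K) ⋆ (Cₓ ⋆ E ⊕ (- 1#) · δ)) n ∎
    where
    J : Carrier
    J = ((Cₓ ⋆ K) ⋆ (Cₓ ⋆ E)) n

  Cₓ⋆E-vanish : ∀ n → (Cₓ ⋆ E) (suc n) ≈ 0#
  Cₓ⋆E-vanish n = begin
    (Cₓ ⋆ E) (suc n)    ≈⟨ sym (defect-suc n) ⟩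
    defect (suc n)      ≈⟨ ⋆-ode-vanish (Cₓ ⋆ K) defect defect₀ (λ m → trans (defect-suc m) (Cₓ⋆E-step m)) (suc n) ⟩
    0#                  ∎
    where
    defect : Seq
    defect = Cₓ ⋆ E ⊕ (- 1#) · δ
    defect₀ : defect 0 ≈ 0#
    defect₀ = solve 0 ((:1 :* :1) :+ (:- :1) :* :1 := :0) refl
    defect-suc : ∀ m → defect (suc m) ≈ (Cₓ ⋆ E) (suc m)
    defect-suc m = trans (+-congˡ (zeroʳ _)) (+-identityʳ _)

  private
    E-suc-positive : ∀ {k} → 0 < k → E (suc k) ≡.≡ - Cₓ k
    E-suc-positive {suc k} _ = ≡.refl

  binomialTerm-E : ∀ n j → j < suc n → binomialTerm (suc n) Cₓ E j ≈ (- 1#) * (h x (suc n) (suc j) * Cₓ j)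
  binomialTerm-E n j j<1+n with ℕ.m≤n⇒m<n∨m≡n (ℕ.≤-pred j<1+n)
  ... | inj₁ j<n = begin
    fromℕ (suc n C j) * (Cₓ j * E (suc n ∸ j))
      ≡⟨ ≡.cong (λ e → fromℕ (suc n C j) * (Cₓ j * e))
                (≡.trans (≡.cong E (ℕ.+-∸-assoc 1 (ℕ.<⇒≤ j<n))) (E-suc-positive (ℕ.m<n⇒0<n∸m j<n))) ⟩
    fromℕ (suc n C j) * (Cₓ j * - Cₓ (n ∸ j))
      ≈⟨ solve 3 (λ b c d → b :* (c :* :- d) := (:- :1) :* ((b :* d) :* c)) refl _ _ _ ⟩
    (- 1#) * ((fromℕ (suc n C j) * Cₓ (n ∸ j)) * Cₓ j)
      ≡⟨ ≡.cong (λ e → (- 1#) * (e * Cₓ j)) (h-below j<n) ⟨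
    (- 1#) * (h x (suc n) (suc j) * Cₓ j) ∎
  ... | inj₂ ≡.refl = begin
    fromℕ (suc n C n) * (Cₓ n * E (suc n ∸ n))
      ≡⟨ ≡.cong (λ k → fromℕ (suc n C n) * (Cₓ n * E k)) (ℕ.m+n∸n≡m 1 n) ⟩
    fromℕ (suc n C n) * (Cₓ n * - x)
      ≈⟨ solve 3 (λ b c x → b :* (c :* :- x) := (:- :1) :* ((b :* x) :* c)) refl _ _ x ⟩
    (- 1#) * ((fromℕ (suc n C n) * x) * Cₓ n)
      ≡⟨ ≡.cong (λ e → (- 1#) * (e * Cₓ n)) (h-diagonal n) ⟨
    (- 1#) * (h x (suc n) (suc n) * Cₓ n) ∎

  Cₓ-hessenberg : ∀ n → Cₓ (suc n) ≈ Σ< (suc n) (λ j → h x (suc n) (suc j) * Cₓ j)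
  Cₓ-hessenberg n = begin
    Cₓ (suc n)                          ≈⟨ solve 2 (λ S c → c := ((:- :1) :* S :+ c) :+ S) refl S (Cₓ (suc n)) ⟩
    ((- 1#) * S + Cₓ (suc n)) + S       ≈⟨ +-congʳ (sym expansion) ⟩
    (Cₓ ⋆ E) (suc n) + S                ≈⟨ +-congʳ (Cₓ⋆E-vanish n) ⟩
    0# + S                              ≈⟨ +-identityˡ S ⟩
    S                                   ∎
    where
    S : Carrier
    S = Σ< (suc n) (λ j → h x (suc n) (suc j) * Cₓ j)
    last : binomialTerm (suc n) Cₓ E (suc n) ≈ Cₓ (suc n)
    last = begin
      fromℕ (suc n C suc n) * (Cₓ (suc n) * E (n ∸ n))
        ≡⟨ ≡.cong₂ (λ k l → fromℕ k * (Cₓ (suc n) * E l)) (nCn≡1 (suc n)) (ℕ.n∸n≡0 n) ⟩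
      (1# + 0#) * (Cₓ (suc n) * 1#)
        ≈⟨ solve 1 (λ c → (:1 :+ :0) :* (c :* :1) := c) refl _ ⟩
      Cₓ (suc n) ∎
    expansion : (Cₓ ⋆ E) (suc n) ≈ (- 1#) * S + Cₓ (suc n)
    expansion = begin
      (Cₓ ⋆ E) (suc n)
        ≈⟨ ⋆-binomial (suc n) Cₓ E ⟩
      Σ< (suc (suc n)) (binomialTerm (suc n) Cₓ E)
        ≈⟨ Σ<-snoc (suc n) (binomialTerm (suc n) Cₓ E) ⟩
      Σ< (suc n) (binomialTerm (suc n) Cₓ E) + binomialTerm (suc n) Cₓ E (suc n)
        ≈⟨ +-cong (trans (Σ<-cong (suc n) (binomialTerm-E n)) (Σ<-· (suc n) (- 1#) (λ j → h x (suc n) (suc j) * Cₓ j))) last ⟩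
      (- 1#) * S + Cₓ (suc n) ∎

theorem2p4 : ∀ {c ℓ : Level} (R : CommutativeRing c ℓ) (x : CommutativeRing.Carrier R) (n : ℕ) →
    1 ≤ n → CommutativeRing._≈_ R (WithRing.Cₙ R x n) (WithRing.det R n (WithRing.H R x n))
theorem2p4 R x n _ = begin
  Cₙ x n            ≈⟨ recurrence-unique entries {Cₙ x} {detH entries} refl Cₓ-hessenberg (λ m → detH-recurrence m entries) n ⟩
  detH entries n    ≈⟨ det-cong n (λ r s → sym (hessenberg-unique entries entries-super entries-upper (toℕ r) (toℕ s))) ⟩
  det n (H x n)     ∎
  where
  open CommutativeRing R
  open WithRing R using (Cₙ; det; H)
  open HessenbergDeterminant R
  open HessenbergEntries R x using (entries; entries-super; entries-upper)
  open EulerianReciprocal R x using (Cₓ-hessenberg)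
  open import Relation.Binary.Reasoning.Setoid setoid
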